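{- For any monoidal signature $\Sigma$, morphisms of preordered cartesian bicategories $\mathcal M:\mathbb{CB}^{\leq}_{\Sigma}\to\mathsf{Span}^{\leq}(\mathbf{Set})$ are in bijective correspondence with (possibly infinite) $\Sigma$-hypergraphs.
   Context: A monoidal signature $\Sigma$ is a set of symbols each with an arity $n$ and coarity $m$ ($\Sigma_{n,m}$ those with arity $n$, coarity $m$). A $\Sigma$-hypergraph $G$ is a set $G_V$ and, for each $R\in\Sigma_{n,m}$, a set $G_R$ with functions $s_R:G_R\to(G_V)^n$, $t_R:G_R\to(G_V)^m$. GCQ terms with sorts $(n,m)$ are generated by constants $\delta:(1,2)$, $\varepsilon:(1,0)$, $\mu:(2,1)$, $\eta:(0,1)$, $\mathrm{id}_0:(0,0)$, $\mathrm{id}_1:(1,1)$, $\sigma:(2,2)$, symbols $R\in\Sigma_{n,m}$ of sort $(n,m)$, $c;d$ ($(n,z),(z,m)\mapsto(n,m)$), $c\oplus d$ ($(n,m),(p,q)\mapsto(n+p,m+q)$). With $\mathrm{id}_n$, symmetries $\sigma_{n,m}$, $\varepsilon_0=\mathrm{id}_0$, $\varepsilon_{n+1}=\varepsilon\oplus\varepsilon_n$, $\delta_0=\mathrm{id}_0$, $\delta_{n+1}=(\delta\oplus\delta_n);(\mathrm{id}_1\oplus\sigma_{1,n}\oplus\mathrm{id}_n)$: $\mathbb{CB}^{\leq}_\Sigma$ has objects natural numbers, arrows $n\to m$ the terms of sort $(n,m)$ modulo the smallest congruence generated by the strict symmetric monoidal category laws (symmetry generated by $\sigma$), commutative comonoid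 laws for $\delta,\varepsilon$, commutative monoid laws for $\mu,\eta$, the Frobenius law $(\delta\oplus\mathrm{id}_1);(\mathrm{id}_1\oplus\mu)=\mu;\delta=(\mathrm{id}_1\oplus\delta);(\mu\oplus\mathrm{id}_1)$ and $\delta;\mu=\mathrm{id}_1$, ordered by the smallest precongruence generated by $\mathrm{id}_1\le\varepsilon;\eta$, $\eta;\varepsilon\le\mathrm{id}_0$, $\mathrm{id}_1\le\delta;\mu$, $\mu;\delta\le\mathrm{id}_2$ and, for $R\in\Sigma_{n,m}$, $R;\delta_m\le\delta_n;(R\oplus R)$, $R;\varepsilon_m\le\varepsilon_n$. Its monoid/comonoid on $n$ are the $n$-fold lifts of $\mu,\eta,\delta,\varepsilon$. $\mathsf{Span}^{\leq}(\mathbf{Set})$ has sets as objects, isomorphism classes of spans $X\leftarrow A\to Y$ as arrows, composition by pullback, tensor the cartesian product, preorder $(X\leftarrow A\to Y)\le(X\leftarrow B\to Y)$ iff there is a function $A\to B$ commuting with the legs, comonoid $X\xleftarrow{\mathrm{id}}X\xrightarrow{\langle\mathrm{id},\mathrm{id}\rangle}X\times X$, $X\xleftarrow{\mathrm{id}}X\to1$ and monoid the reversed spans. A preordered cartesian bicategory is a symmetric monoidal category with preordered homs in which every object carries a special commutative Frobenius bimonoid $(\mu_X,\eta_X,\delta_X,\varepsilon_X)$ with $\mathrm{id}_X\le\varepsilon_X;\eta_X$, $\eta_X;\varepsilon_X\le\mathrm{id}_I$, $\mathrm{id}_X\le\delta_X;\mu_X$, $\mu_X;\delta_X\le\mathrm{id}_{X\oplus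 X}$ and every arrow lax comonoid morphism ($R;\delta_Y\le\delta_X;(R\oplus R)$, $R;\varepsilon_Y\le\varepsilon_X$); a morphism of them is a monoidal functor preserving the preorders, monoids and comonoids. -}

module Defs where

open import Data.Nat using (ℕ; zero; suc; _+_)
open import Data.Nat.Properties using (+-assoc; +-identityʳ)
open import Data.Product using (Σ; _×_; _,_; proj₁; proj₂)
open import Data.Unit using (⊤; tt)
open import Data.Vec using (Vec; []; _∷_; map)
open import Function.Bundles using (_↔_; Inverse)
open import Relation.Binary.PropositionalEquality using (_≡_; refl; sym; subst)

record Signature : Set₁ where
  field
    Sym  : Set
    ar   : Sym → ℕ
    coar : Sym → ℕ

record Hypergraph (S : Signature) : Set₁ where
  open Signature S
  field
    V   : Set
    E   : Sym → Set
    src : ∀ {R} → E R → Vec V (ar R)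
    tgt : ∀ {R} → E R → Vec V (coar R)

record HypIso {S : Signature} (G H : Hypergraph S) : Set where
  open Signature S
  private
    module G = Hypergraph G
    module H = Hypergraph H
  field
    isoV   : G.V ↔ H.V
    isoE   : ∀ R → G.E R ↔ H.E R
    srcCom : ∀ R (e : G.E R) →
             H.src (Inverse.to (isoE R) e) ≡ map (Inverse.to isoV) (G.src e)
    tgtCom : ∀ R (e : G.E R) →
             H.tgt (Inverse.to (isoE R) e) ≡ map (Inverse.to isoV) (G.tgt e)

-- GCQ terms and the free preordered cartesian bicategory CB≤_Σ

module _ (S : Signature) where
  open Signature S

  infixl 5 _⨾_
  infixl 6 _⊕_

  data Term : ℕ → ℕ → Set where
    δ   : Term 1 2
    ε   : Term 1 0
    μ   : Term 2 1
    η   : Term 0 1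
    id₀ : Term 0 0
    id₁ : Term 1 1
    σ   : Term 2 2
    gen : (R : Sym) → Term (ar R) (coar R)
    _⨾_ : ∀ {n z m} → Term n z → Term z m → Term n m
    _⊕_ : ∀ {n m p q} → Term n m → Term p q → Term (n + p) (m + q)

module _ {S : Signature} where
  open Signature S

  cast : ∀ {n n' m m'} → n ≡ n' → m ≡ m' → Term S n m → Term S n' m'
  cast refl refl t = t

  idₙ : ∀ n → Term S n n
  idₙ zero    = id₀
  idₙ (suc n) = id₁ ⊕ idₙ n

  σ₁ : ∀ m → Term S (suc m) (m + 1)
  σ₁ zero    = id₁
  σ₁ (suc m) = (σ ⊕ idₙ m) ⨾ (id₁ ⊕ σ₁ m)

  σₙ : ∀ n m → Term S (n + m) (m + n)
  σₙ zero    m = cast refl (sym (+-identityʳ m)) (idₙ m)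
  σₙ (suc n) m = (id₁ ⊕ σₙ n m) ⨾ cast refl (+-assoc m 1 n) (σ₁ m ⊕ idₙ n)

  εₙ : ∀ n → Term S n 0
  εₙ zero    = id₀
  εₙ (suc n) = ε ⊕ εₙ n

  ηₙ : ∀ n → Term S 0 n
  ηₙ zero    = id₀
  ηₙ (suc n) = η ⊕ ηₙ n

  δₙ : ∀ n → Term S n (n + n)
  δₙ zero    = id₀
  δₙ (suc n) = (δ ⊕ δₙ n) ⨾ cast refl (+-assoc (suc n) 1 n) (id₁ ⊕ (σₙ 1 n ⊕ idₙ n))

  μₙ : ∀ n → Term S (n + n) n
  μₙ zero    = id₀
  μₙ (suc n) = cast (+-assoc (suc n) 1 n) refl (id₁ ⊕ (σₙ n 1 ⊕ idₙ n)) ⨾ (μ ⊕ μₙ n)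

  infix 4 _≈_ _⊑_

  data _≈_ : ∀ {n m} → Term S n m → Term S n m → Set where
    ≈-refl  : ∀ {n m} {c : Term S n m} → c ≈ c
    ≈-sym   : ∀ {n m} {c d : Term S n m} → c ≈ d → d ≈ c
    ≈-trans : ∀ {n m} {c d e : Term S n m} → c ≈ d → d ≈ e → c ≈ e
    ⨾-cong  : ∀ {n z m} {c c' : Term S n z} {d d' : Term S z m} →
              c ≈ c' → d ≈ d' → c ⨾ d ≈ c' ⨾ d'
    ⊕-cong  : ∀ {n m p q} {c c' : Term S n m} {d d' : Term S p q} →
              c ≈ c' → d ≈ d' → c ⊕ d ≈ c' ⊕ d'
    ⨾-assoc : ∀ {n a b m} (c : Term S n a) (d : Term S a b) (e : Term S b m) →
              (c ⨾ d) ⨾ e ≈ c ⨾ (d ⨾ e)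
    ⨾-idˡ   : ∀ {n m} (c : Term S n m) → idₙ n ⨾ c ≈ c
    ⨾-idʳ   : ∀ {n m} (c : Term S n m) → c ⨾ idₙ m ≈ c
    ⊕-assoc : ∀ {n m p q r s} (c : Term S n m) (d : Term S p q) (e : Term S r s) →
              (c ⊕ d) ⊕ e ≈ cast (sym (+-assoc n p r)) (sym (+-assoc m q s)) (c ⊕ (d ⊕ e))
    ⊕-idˡ   : ∀ {n m} (c : Term S n m) → id₀ ⊕ c ≈ c
    ⊕-idʳ   : ∀ {n m} (c : Term S n m) →
              c ⊕ id₀ ≈ cast (sym (+-identityʳ n)) (sym (+-identityʳ m)) c
    ⊕-id    : ∀ n m → idₙ n ⊕ idₙ m ≈ idₙ (n + m)
    interchange : ∀ {n z m p y q} (c : Term S n z) (d : Term S z m)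
                    (c' : Term S p y) (d' : Term S y q) →
              (c ⨾ d) ⊕ (c' ⨾ d') ≈ (c ⊕ c') ⨾ (d ⊕ d')
    σ-inv   : ∀ n m → σₙ n m ⨾ σₙ m n ≈ idₙ (n + m)
    σ-nat   : ∀ {n m p q} (c : Term S n m) (d : Term S p q) →
              (c ⊕ d) ⨾ σₙ m q ≈ σₙ n p ⨾ (d ⊕ c)
    σ-hexˡ  : ∀ n m p →
              σₙ n (m + p) ≈ cast refl (sym (+-assoc m p n))
                (cast (+-assoc n m p) (+-assoc m n p) (σₙ n m ⊕ idₙ p)
                 ⨾ (idₙ m ⊕ σₙ n p))
    σ-hexʳ  : ∀ n m p →
              σₙ (n + m) p ≈ cast (sym (+-assoc n m p)) refl
                ((idₙ n ⊕ σₙ m p)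
                 ⨾ cast (+-assoc n p m) (+-assoc p n m) (σₙ n p ⊕ idₙ m))
    δ-coassoc : δ ⨾ (δ ⊕ id₁) ≈ δ ⨾ (id₁ ⊕ δ)
    δ-counitˡ : δ ⨾ (ε ⊕ id₁) ≈ id₁
    δ-counitʳ : δ ⨾ (id₁ ⊕ ε) ≈ id₁
    δ-comm    : δ ⨾ σ ≈ δ
    μ-assoc   : (μ ⊕ id₁) ⨾ μ ≈ (id₁ ⊕ μ) ⨾ μ
    μ-unitˡ   : (η ⊕ id₁) ⨾ μ ≈ id₁
    μ-unitʳ   : (id₁ ⊕ η) ⨾ μ ≈ id₁
    μ-comm    : σ ⨾ μ ≈ μ
    frobˡ     : (δ ⊕ id₁) ⨾ (id₁ ⊕ μ) ≈ μ ⨾ δ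
    frobʳ     : (id₁ ⊕ δ) ⨾ (μ ⊕ id₁) ≈ μ ⨾ δ
    special   : δ ⨾ μ ≈ id₁

  data _⊑_ : ∀ {n m} → Term S n m → Term S n m → Set where
    ≈⇒⊑      : ∀ {n m} {c d : Term S n m} → c ≈ d → c ⊑ d
    ⊑-trans  : ∀ {n m} {c d e : Term S n m} → c ⊑ d → d ⊑ e → c ⊑ e
    ⨾-mono   : ∀ {n z m} {c c' : Term S n z} {d d' : Term S z m} →
               c ⊑ c' → d ⊑ d' → c ⨾ d ⊑ c' ⨾ d'
    ⊕-mono   : ∀ {n m p q} {c c' : Term S n m} {d d' : Term S p q} →
               c ⊑ c' → d ⊑ d' → c ⊕ d ⊑ c' ⊕ d'
    ax-εη    : id₁ ⊑ ε ⨾ η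
    ax-ηε    : η ⨾ ε ⊑ id₀
    ax-δμ    : id₁ ⊑ δ ⨾ μ
    ax-μδ    : μ ⨾ δ ⊑ idₙ 2
    ax-δ     : ∀ R → gen R ⨾ δₙ (coar R) ⊑ δₙ (ar R) ⨾ (gen R ⊕ gen R)
    ax-ε     : ∀ R → gen R ⨾ εₙ (coar R) ⊑ εₙ (ar R)

record Span (X Y : Set) : Set₁ where
  constructor span
  field
    apex : Set
    lft  : apex → X
    rgt  : apex → Y
open Span public

module _ {X Y : Set} where
  infix 4 _≅ˢ_ _≤ˢ_

  -- equality of arrows: isomorphism of spans
  _≅ˢ_ : Span X Y → Span X Y → Set
  s ≅ˢ t = Σ (apex s ↔ apex t) λ f →
             (∀ a → lft t (Inverse.to f a) ≡ lft s a) ×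
             (∀ a → rgt t (Inverse.to f a) ≡ rgt s a)

  _≤ˢ_ : Span X Y → Span X Y → Set
  s ≤ˢ t = Σ (apex s → apex t) λ f →
             (∀ a → lft t (f a) ≡ lft s a) × (∀ a → rgt t (f a) ≡ rgt s a)

infixl 5 _⨾ˢ_
infixl 6 _⊗ˢ_

_⨾ˢ_ : ∀ {X Y Z} → Span X Y → Span Y Z → Span X Z
s ⨾ˢ t = span (Σ (apex s × apex t) λ p → rgt s (proj₁ p) ≡ lft t (proj₂ p))
              (λ q → lft s (proj₁ (proj₁ q)))
              (λ q → rgt t (proj₂ (proj₁ q)))

_⊗ˢ_ : ∀ {X Y X' Y'} → Span X Y → Span X' Y' → Span (X × X') (Y × Y')
s ⊗ˢ t = span (apex s × apex t)
              (λ p → lft s (proj₁ p) , lft t (proj₂ p))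
              (λ p → rgt s (proj₁ p) , rgt t (proj₂ p))

idˢ : ∀ X → Span X X
idˢ X = span X (λ x → x) (λ x → x)

graph : ∀ {X Y} → (X → Y) → Span X Y
graph {X} f = span X (λ x → x) f

δˢ : ∀ X → Span X (X × X)
δˢ X = span X (λ x → x) (λ x → x , x)

εˢ : ∀ X → Span X ⊤
εˢ X = span X (λ x → x) (λ _ → tt)

μˢ : ∀ X → Span (X × X) X
μˢ X = span X (λ x → x , x) (λ x → x)

ηˢ : ∀ X → Span ⊤ X
ηˢ X = span X (λ _ → tt) (λ x → x)

-- Morphisms of preordered cartesian bicategories CB≤_Σ → Span≤(Set)
-- (strong monoidal functor, preserving preorder, monoids and comonoids)

record Morph (S : Signature) : Set₁ where
  field
    Ob    : ℕ → Set
    Hom   : ∀ {n m} → Term S n m → Span (Ob n) (Ob m)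
    Hom-≈ : ∀ {n m} {c d : Term S n m} → c ≈ d → Hom c ≅ˢ Hom d
    Hom-⊑ : ∀ {n m} {c d : Term S n m} → c ⊑ d → Hom c ≤ˢ Hom d
    Hom-id : ∀ n → Hom (idₙ n) ≅ˢ idˢ (Ob n)
    Hom-⨾  : ∀ {n z m} (c : Term S n z) (d : Term S z m) →
             Hom (c ⨾ d) ≅ˢ Hom c ⨾ˢ Hom d
    φ     : ∀ n m → (Ob n × Ob m) ↔ Ob (n + m)
    φ₀    : ⊤ ↔ Ob 0
    φ-nat : ∀ {n m p q} (c : Term S n m) (d : Term S p q) →
            graph (Inverse.to (φ n p)) ⨾ˢ Hom (c ⊕ d)
              ≅ˢ (Hom c ⊗ˢ Hom d) ⨾ˢ graph (Inverse.to (φ m q))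
    φ-assoc : ∀ n m p (x : Ob n) (y : Ob m) (z : Ob p) →
            Inverse.to (φ (n + m) p) (Inverse.to (φ n m) (x , y) , z)
              ≡ subst Ob (sym (+-assoc n m p))
                  (Inverse.to (φ n (m + p)) (x , Inverse.to (φ m p) (y , z)))
    φ-unitˡ : ∀ n (x : Ob n) → Inverse.to (φ 0 n) (Inverse.to φ₀ tt , x) ≡ x
    φ-unitʳ : ∀ n (x : Ob n) →
            Inverse.to (φ n 0) (x , Inverse.to φ₀ tt) ≡ subst Ob (sym (+-identityʳ n)) x
    pres-δ : ∀ n → Hom (δₙ n) ⨾ˢ graph (Inverse.from (φ n n)) ≅ˢ δˢ (Ob n)
    pres-ε : ∀ n → Hom (εₙ n) ⨾ˢ graph (Inverse.from φ₀) ≅ˢ εˢ (Ob n)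
    pres-μ : ∀ n → graph (Inverse.to (φ n n)) ⨾ˢ Hom (μₙ n) ≅ˢ μˢ (Ob n)
    pres-η : ∀ n → graph (Inverse.to φ₀) ⨾ˢ Hom (ηₙ n) ≅ˢ ηˢ (Ob n)

record MorphIso {S : Signature} (M N : Morph S) : Set₁ where
  private
    module M = Morph M
    module N = Morph N
  field
    α    : ∀ n → M.Ob n ↔ N.Ob n
    nat  : ∀ {n m} (c : Term S n m) →
           M.Hom c ⨾ˢ graph (Inverse.to (α m)) ≅ˢ graph (Inverse.to (α n)) ⨾ˢ N.Hom c
    mon  : ∀ n m (x : M.Ob n) (y : M.Ob m) →
           Inverse.to (α (n + m)) (Inverse.to (M.φ n m) (x , y))
             ≡ Inverse.to (N.φ n m) (Inverse.to (α n) x , Inverse.to (α m) y)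
    mon₀ : Inverse.to (α 0) (Inverse.to M.φ₀ tt) ≡ Inverse.to N.φ₀ tt

module _ {S : Signature} (M : Morph S) where
  open Morph M

  unpack : ∀ n → Ob n → Vec (Ob 1) n
  unpack zero    _ = []
  unpack (suc n) x with Inverse.from (φ 1 n) x
  ... | (v , xs) = v ∷ unpack n xs

  hypergraphOf : Hypergraph S
  hypergraphOf = record
    { V   = Ob 1
    ; E   = λ R → apex (Hom (gen R))
    ; src = λ {R} e → unpack (Signature.ar S R) (lft (Hom (gen R)) e)
    ; tgt = λ {R} e → unpack (Signature.coar S R) (rgt (Hom (gen R)) e)
    }

module Submission where

-- Spans X ← A → Y are handled through proof-relevant relations X → Y → Set:
-- every relation R has a span spanOf R (apex Σ (x , y). R x y), and composition
-- of spans by pullback corresponds to relational composition _⊙_.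
--
-- For a hypergraph G we interpret every term
-- c : n → m as a relation ⟦ c ⟧ between vectors Vec V n and Vec V m: a generator
-- R relates the source and target vectors of its hyperedges, δ and μ are the
-- graph and cograph of duplication, ε and η are total, σ swaps.
--
-- A morphism N is determined by N(1) and its generators: the
-- monoidal structure identifies N(n) with N(1)ⁿ, preservation of (co)monoids
-- fixes N on δ, ε, μ, η, the symmetry is forced (σ is an involution swapping
-- ε ⊕ id₁ and id₁ ⊕ ε), and induction on terms then gives N ≅ modelOf G as
-- soon as G has vertices N(1) and generators agreeing with N.
--
-- The four clauses of the theorem follow: isos of morphisms restrict to isos
-- of hypergraphs, and the other three clauses are instances of rigidity.

open import Defs
open import Axiom.UniquenessOfIdentityProofs.WithK using (uip)
open import Data.Nat using (ℕ; zero; suc; _+_)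
open import Data.Nat.Properties using (+-assoc; +-identityʳ)
open import Data.Product using (Σ; _×_; _,_; proj₁; proj₂; uncurry; swap) renaming (map to map×)
open import Data.Product.Algebra using (×-comm)
open import Data.Product.Function.Dependent.Propositional using (Σ-↔)
open import Data.Product.Function.NonDependent.Propositional using (_×-↔_)
open import Data.Unit using (⊤; tt)
open import Data.Vec using (Vec; []; _∷_; _++_; toList; map)
open import Data.Vec.Properties using (toList-injective; toList-++)
open import Data.Vec.Relation.Binary.Equality.Cast using (cast-is-id)
import Data.List as List
import Data.List.Properties as ListP
open import Function.Base using (_∘_; id)
open import Function.Bundles using (_↔_; Inverse; mk↔ₛ′)
open import Function.Properties.Inverse using (↔-refl; ↔-sym; ↔-trans)
open import Relation.Binary.PropositionalEquality

open Inverse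

module TypeIsos where

  ≡↔ : {A B : Set} → A ≡ B → A ↔ B
  ≡↔ refl = ↔-refl

  unitL : {A : Set} → A ↔ (⊤ × A)
  unitL = mk↔ₛ′ (tt ,_) proj₂ (λ _ → refl) (λ _ → refl)

  unitR : {A : Set} → A ↔ (A × ⊤)
  unitR = mk↔ₛ′ (_, tt) proj₁ (λ _ → refl) (λ _ → refl)

  assocI : {A B C : Set} → ((A × B) × C) ↔ (A × (B × C))
  assocI = mk↔ₛ′ (λ { ((a , b) , c) → a , b , c }) (λ { (a , b , c) → (a , b) , c })
                 (λ _ → refl) (λ _ → refl)

  subst2I : {X Y : Set} (R : X → Y → Set) {x x' : X} {y y' : Y} → x ≡ x' → y ≡ y' → R x y ↔ R x' y'
  subst2I R p q = ≡↔ (cong₂ R p q)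

  propI : {A B : Set} → (∀ (a a' : A) → a ≡ a') → (∀ (b b' : B) → b ≡ b') →
          (A → B) → (B → A) → A ↔ B
  propI pA pB f g = mk↔ₛ′ f g (λ b → pB _ _) (λ a → pA _ _)

open TypeIsos

module SpanCalculus where

  -- a wrapper around _≅ˢ_ whose indices Agda can infer from the type
  infix 4 _≅_
  record _≅_ {X Y : Set} (s t : Span X Y) : Set where
    constructor ⟪_⟫
    field un : s ≅ˢ t
  open _≅_ public

  module _ {X Y : Set} where
    mk≅ : {s t : Span X Y} (f : apex s ↔ apex t) →
          (∀ a → lft t (to f a) ≡ lft s a) → (∀ a → rgt t (to f a) ≡ rgt s a) → s ≅ t
    mk≅ f l r = ⟪ f , l , r ⟫

    ≅refl : {s : Span X Y} → s ≅ s
    ≅refl = ⟪ ↔-refl , (λ _ → refl) , (λ _ → refl) ⟫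

    ≅sym : {s t : Span X Y} → s ≅ t → t ≅ s
    ≅sym {s} {t} ⟪ f , l , r ⟫ = ⟪ ↔-sym f ,
      (λ b → trans (sym (l (from f b))) (cong (lft t) (strictlyInverseˡ f b))) ,
      (λ b → trans (sym (r (from f b))) (cong (rgt t) (strictlyInverseˡ f b))) ⟫

    ≅trans : {s t u : Span X Y} → s ≅ t → t ≅ u → s ≅ u
    ≅trans ⟪ f , l , r ⟫ ⟪ g , l' , r' ⟫ = ⟪ ↔-trans f g ,
      (λ a → trans (l' (to f a)) (l a)) , (λ a → trans (r' (to f a)) (r a)) ⟫

    ≅at : (s : Span X Y) → s ≅ s
    ≅at s = ≅refl

    reindex : {A B : Set} (e : A ↔ B) (l : B → X) (r : B → Y) →
              span A (l ∘ to e) (r ∘ to e) ≅ span B l r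
    reindex e l r = ⟪ e , (λ _ → refl) , (λ _ → refl) ⟫

    mapLegs : {X' Y' : Set} (f : X → X') (g : Y → Y') {s t : Span X Y} → s ≅ t →
              span (apex s) (f ∘ lft s) (g ∘ rgt s) ≅ span (apex t) (f ∘ lft t) (g ∘ rgt t)
    mapLegs f g ⟪ e , l , r ⟫ = ⟪ e , (λ a → cong f (l a)) , (λ a → cong g (r a)) ⟫

    legsExt : {A : Set} {l l' : A → X} {r r' : A → Y} →
              (∀ a → l a ≡ l' a) → (∀ a → r a ≡ r' a) → span A l r ≅ span A l' r'
    legsExt el er = ⟪ ↔-refl , (λ a → sym (el a)) , (λ a → sym (er a)) ⟫

  step-≅ : {X Y : Set} (s : Span X Y) {t u : Span X Y} → t ≅ u → s ≅ t → s ≅ u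
  step-≅ s q p = ≅trans p q

  infixr 2 step-≅
  syntax step-≅ s q p = s ≅⟨ p ⟩ q
  infix 3 _∎ˢ

  _∎ˢ : {X Y : Set} (s : Span X Y) → s ≅ s
  s ∎ˢ = ≅refl

  module _ {X Y Z : Set} where
    s⨾-cong : {s s' : Span X Y} {t t' : Span Y Z} → s ≅ s' → t ≅ t' → s ⨾ˢ t ≅ s' ⨾ˢ t'
    s⨾-cong {s} {s'} {t} {t'} ⟪ f , l , r ⟫ ⟪ g , l' , r' ⟫ = ⟪
      Σ-↔ (f ×-↔ g) (λ {x} → ≡↔ (cong₂ _≡_ (sym (r (proj₁ x))) (sym (l' (proj₂ x))))) ,
      (λ _ → l _) , (λ _ → r' _) ⟫

    ⨾-graph : (s : Span X Y) (g : Y → Z) → s ⨾ˢ graph g ≅ span (apex s) (lft s) (g ∘ rgt s)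
    ⨾-graph s g = ⟪ mk↔ₛ′ (λ z → proj₁ (proj₁ z)) (λ a → (a , rgt s a) , refl) (λ _ → refl) gf ,
                  (λ _ → refl) , (λ { ((a , y) , refl) → refl }) ⟫
      where
      gf : ∀ z → ((proj₁ (proj₁ z) , rgt s (proj₁ (proj₁ z))) , refl) ≡ z
      gf ((a , y) , refl) = refl

    cograph-⨾ : (f : Y → X) (t : Span Y Z) → span Y f id ⨾ˢ t ≅ span (apex t) (f ∘ lft t) (rgt t)
    cograph-⨾ f t = ⟪ mk↔ₛ′ (λ z → proj₂ (proj₁ z)) (λ b → (lft t b , b) , refl) (λ _ → refl) gf ,
                    (λ { ((y , b) , refl) → refl }) , (λ _ → refl) ⟫
      where
      gf : ∀ z → ((lft t (proj₂ (proj₁ z)) , proj₂ (proj₁ z)) , refl) ≡ z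
      gf ((y , b) , refl) = refl

  s⨾-assoc : {W X Y Z : Set} (s : Span W X) (t : Span X Y) (u : Span Y Z) →
             (s ⨾ˢ t) ⨾ˢ u ≅ s ⨾ˢ (t ⨾ˢ u)
  s⨾-assoc s t u = ⟪
    mk↔ₛ′ (λ { ((((a , b) , p) , c) , q) → (a , ((b , c) , q)) , p })
          (λ { ((a , ((b , c) , q)) , p) → (((a , b) , p) , c) , q })
          (λ { ((a , ((b , c) , q)) , p) → refl }) (λ { ((((a , b) , p) , c) , q) → refl }) ,
    (λ _ → refl) , (λ _ → refl) ⟫

  module _ {X Y : Set} where
    s⨾-idˡ : (s : Span X Y) → idˢ X ⨾ˢ s ≅ s
    s⨾-idˡ s = cograph-⨾ id s

    s⨾-idʳ : (s : Span X Y) → s ⨾ˢ idˢ Y ≅ s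
    s⨾-idʳ s = ⨾-graph s id

  graph-⨾ : {X Y Z : Set} (f : X → Y) (g : Y → Z) → graph f ⨾ˢ graph g ≅ graph (g ∘ f)
  graph-⨾ f g = ⨾-graph (graph f) g

  graph-ext : {X Y : Set} {f g : X → Y} → (∀ x → f x ≡ g x) → graph f ≅ graph g
  graph-ext e = legsExt (λ _ → refl) e

  graph-eq : {X Y : Set} {f g : X → Y} → graph f ≅ graph g → ∀ x → f x ≡ g x
  graph-eq {g = g} ⟪ e , l , r ⟫ x = trans (sym (r x)) (cong g (l x))

  graphFrom : {X Y : Set} (e : X ↔ Y) → graph (from e) ≅ span X (to e) id
  graphFrom e = ⟪ ↔-sym e , (λ b → strictlyInverseˡ e b) , (λ _ → refl) ⟫

  graphTo : {X Y : Set} (e : X ↔ Y) → graph (to e) ≅ span Y (from e) id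
  graphTo e = ⟪ e , (λ a → strictlyInverseʳ e a) , (λ _ → refl) ⟫

  ⊗-cong : {X Y X' Y' : Set} {s t : Span X Y} {s' t' : Span X' Y'} →
           s ≅ t → s' ≅ t' → s ⊗ˢ s' ≅ t ⊗ˢ t'
  ⊗-cong ⟪ f , l , r ⟫ ⟪ g , l' , r' ⟫ = ⟪ (f ×-↔ g) ,
    (λ a → cong₂ _,_ (l _) (l' _)) , (λ a → cong₂ _,_ (r _) (r' _)) ⟫

  postcancel : {X Y Z : Set} (f : Y → Z) (g : Z → Y) → (∀ y → g (f y) ≡ y) →
               {s : Span X Y} {t : Span X Z} → s ⨾ˢ graph f ≅ t → s ≅ t ⨾ˢ graph g
  postcancel {Y = Y} f g gf {s} {t} p =
    s ≅⟨ ≅sym (s⨾-idʳ s) ⟩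
    s ⨾ˢ idˢ Y ≅⟨ s⨾-cong (≅at s) (graph-ext (λ y → sym (gf y))) ⟩
    s ⨾ˢ graph (g ∘ f) ≅⟨ s⨾-cong (≅at s) (≅sym (graph-⨾ f g)) ⟩
    s ⨾ˢ (graph f ⨾ˢ graph g) ≅⟨ ≅sym (s⨾-assoc s (graph f) (graph g)) ⟩
    (s ⨾ˢ graph f) ⨾ˢ graph g ≅⟨ s⨾-cong p (≅at (graph g)) ⟩
    t ⨾ˢ graph g ∎ˢ

  precancel : {X Y Z : Set} (f : X → Y) (g : Y → X) → (∀ y → f (g y) ≡ y) →
              {s : Span Y Z} {t : Span X Z} → graph f ⨾ˢ s ≅ t → s ≅ graph g ⨾ˢ t
  precancel {Y = Y} f g fg {s} {t} p =
    s ≅⟨ ≅sym (s⨾-idˡ s) ⟩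
    idˢ Y ⨾ˢ s ≅⟨ s⨾-cong (graph-ext (λ y → sym (fg y))) (≅at s) ⟩
    graph (f ∘ g) ⨾ˢ s ≅⟨ s⨾-cong (≅sym (graph-⨾ g f)) (≅at s) ⟩
    (graph g ⨾ˢ graph f) ⨾ˢ s ≅⟨ s⨾-assoc (graph g) (graph f) s ⟩
    graph g ⨾ˢ (graph f ⨾ˢ s) ≅⟨ s⨾-cong (≅at (graph g)) p ⟩
    graph g ⨾ˢ t ∎ˢ

  selfInverse : {X : Set} (s : Span X X) → s ⨾ˢ s ≅ idˢ X → Σ (X → X) (λ t → s ≅ graph t)
  selfInverse {X} s ⟪ f , l , r ⟫ = (rgt s ∘ linv) , mk≅ lI (λ _ → refl) (λ a → cong (rgt s) (retr a))
    where
    linv : X → apex s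
    linv x = proj₁ (proj₁ (from f x))
    sec : ∀ x → lft s (linv x) ≡ x
    sec x = trans (sym (l (from f x))) (strictlyInverseˡ f x)
    retr : ∀ a → linv (lft s a) ≡ a
    retr a = cong (λ z → proj₁ (proj₁ z))
               (trans (cong (from f) (sym (l p))) (strictlyInverseʳ f p))
      where
      p : apex (s ⨾ˢ s)
      p = (a , linv (rgt s a)) , sym (sec (rgt s a))
    lI : apex s ↔ X
    lI = mk↔ₛ′ (lft s) linv sec retr

open SpanCalculus

module Relations where

  Fam : Set → Set → Set₁
  Fam X Y = X → Y → Set

  spanOf : {X Y : Set} → Fam X Y → Span X Y
  spanOf {X} {Y} R = span (Σ (X × Y) (uncurry R)) (λ z → proj₁ (proj₁ z)) (λ z → proj₂ (proj₁ z))

  infix 4 _≈F_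
  _≈F_ : {X Y : Set} → Fam X Y → Fam X Y → Set
  R ≈F T = ∀ x y → R x y ↔ T x y

  _⊆F_ : {X Y : Set} → Fam X Y → Fam X Y → Set
  R ⊆F T = ∀ x y → R x y → T x y

  infixl 5 _⊙_
  _⊙_ : {X Y Z : Set} → Fam X Y → Fam Y Z → Fam X Z
  _⊙_ {Y = Y} R T x z = Σ Y λ y → R x y × T y z

  transpose : {X Y : Set} → Fam X Y → Fam Y X
  transpose R y x = R x y

  ≈Frefl : {X Y : Set} {R : Fam X Y} → R ≈F R
  ≈Frefl x y = ↔-refl

  ≈Fsym : {X Y : Set} {R T : Fam X Y} → R ≈F T → T ≈F R
  ≈Fsym e x y = ↔-sym (e x y)

  ≈Ftrans : {X Y : Set} {R T U : Fam X Y} → R ≈F T → T ≈F U → R ≈F U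
  ≈Ftrans e e' x y = ↔-trans (e x y) (e' x y)

  ⊙-cong : {X Y Z : Set} {R R' : Fam X Y} {T T' : Fam Y Z} → R ≈F R' → T ≈F T' → R ⊙ T ≈F R' ⊙ T'
  ⊙-cong e e' x z = Σ-↔ ↔-refl (λ {y} → e x y ×-↔ e' y z)

  ⊙-assoc : {W X Y Z : Set} (R : Fam W X) (T : Fam X Y) (U : Fam Y Z) → (R ⊙ T) ⊙ U ≈F R ⊙ (T ⊙ U)
  ⊙-assoc R T U w z = mk↔ₛ′ (λ { (y , (x , r , s) , t) → x , r , y , s , t })
                             (λ { (x , r , y , s , t) → y , (x , r , s) , t })
                             (λ { (x , r , y , s , t) → refl }) (λ { (y , (x , r , s) , t) → refl })

  spanOf-cong : {X Y : Set} {R T : Fam X Y} → R ≈F T → spanOf R ≅ spanOf T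
  spanOf-cong e = ⟪ Σ-↔ ↔-refl (λ {x} → e (proj₁ x) (proj₂ x)) , (λ _ → refl) , (λ _ → refl) ⟫

  spanOf-mono : {X Y : Set} {R T : Fam X Y} → R ⊆F T → spanOf R ≤ˢ spanOf T
  spanOf-mono f = (λ { ((x , y) , r) → (x , y) , f x y r }) , (λ _ → refl) , (λ _ → refl)

  spanOf-⨾ : {X Y Z : Set} (R : Fam X Y) (T : Fam Y Z) → spanOf (R ⊙ T) ≅ spanOf R ⨾ˢ spanOf T
  spanOf-⨾ R T = ⟪
    mk↔ₛ′ (λ { ((x , z) , y , r , s) → (((x , y) , r) , ((y , z) , s)) , refl })
          g (λ { ((((x , y) , r) , ((y' , z) , s)) , refl) → refl }) (λ { ((x , z) , y , r , s) → refl }) ,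
    (λ _ → refl) , (λ _ → refl) ⟫
    where
    g : apex (spanOf R ⨾ˢ spanOf T) → apex (spanOf (R ⊙ T))
    g ((((x , y) , r) , ((y' , z) , s)) , refl) = (x , z) , y , r , s

open Relations

module Vectors (V : Set) where

  Vn : ℕ → Set
  Vn n = Vec V n

  -- Pointwise equality of vectors, by recursion so that it unfolds along the
  -- vectors; it is a proposition equivalent to _≡_ (IdV⇒≡, ≡⇒IdV, IdV-prop).
  IdV : ∀ {n} → Vn n → Vn n → Set
  IdV [] [] = ⊤
  IdV (x ∷ xs) (y ∷ ys) = (x ≡ y) × IdV xs ys

  reflV : ∀ {n} (v : Vn n) → IdV v v
  reflV [] = tt
  reflV (x ∷ v) = refl , reflV v

  IdV⇒≡ : ∀ {n} {v w : Vn n} → IdV v w → v ≡ w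
  IdV⇒≡ {v = []} {[]} _ = refl
  IdV⇒≡ {v = x ∷ v} {y ∷ w} (refl , q) = cong (x ∷_) (IdV⇒≡ q)

  ≡⇒IdV : ∀ {n} {v w : Vn n} → v ≡ w → IdV v w
  ≡⇒IdV {v = v} refl = reflV v

  IdV-prop : ∀ {n} {v w : Vn n} (p q : IdV v w) → p ≡ q
  IdV-prop {v = []} {[]} tt tt = refl
  IdV-prop {v = x ∷ v} {y ∷ w} (e , p) (e' , q) = cong₂ _,_ (uip e e') (IdV-prop p q)

  IdV-propI : ∀ {n} {v w : Vn n} {n'} {v' w' : Vn n'} →
              (v ≡ w → v' ≡ w') → (v' ≡ w' → v ≡ w) → IdV v w ↔ IdV v' w'
  IdV-propI f g = propI IdV-prop IdV-prop (λ q → ≡⇒IdV (f (IdV⇒≡ q))) (λ q → ≡⇒IdV (g (IdV⇒≡ q)))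

  IdV-symI : ∀ {n} {v w : Vn n} → IdV v w ↔ IdV w v
  IdV-symI = IdV-propI sym sym

  IdV0 : (v w : Vn 0) → IdV v w ↔ ⊤
  IdV0 [] [] = ↔-refl

  module _ {n : ℕ} {v : Vn n} where
    IdV-singl : {w : Vn n} (q : IdV v w) → _≡_ {A = Σ (Vn n) (IdV v)} (v , reflV v) (w , q)
    IdV-singl q with IdV⇒≡ q
    ... | refl = cong (v ,_) (IdV-prop _ _)

    IdV-singl' : {w : Vn n} (q : IdV w v) → _≡_ {A = Σ (Vn n) (λ u → IdV u v)} (v , reflV v) (w , q)
    IdV-singl' q with IdV⇒≡ q
    ... | refl = cong (v ,_) (IdV-prop _ _)

    IdV-contrR : {P : Vn n → Set} → Σ (Vn n) (λ w → IdV v w × P w) ↔ P v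
    IdV-contrR {P} = mk↔ₛ′ out (λ p → v , reflV v , p) out-in in-out
      where
      out : Σ (Vn n) (λ w → IdV v w × P w) → P v
      out (w , q , p) = subst P (sym (IdV⇒≡ q)) p
      out-in : ∀ p → out (v , reflV v , p) ≡ p
      out-in p = cong (λ e → subst P (sym e) p) (uip (IdV⇒≡ (reflV v)) refl)
      in-out : ∀ z → (v , reflV v , out z) ≡ z
      in-out (w , q , p) with IdV⇒≡ q | IdV-singl q
      ... | refl | refl = refl

    IdV-contrL : {P : Vn n → Set} → Σ (Vn n) (λ w → IdV w v × P w) ↔ P v
    IdV-contrL = ↔-trans (Σ-↔ ↔-refl (IdV-symI ×-↔ ↔-refl)) IdV-contrR

  fstV : ∀ n {m} → Vn (n + m) → Vn n
  fstV zero v = []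
  fstV (suc n) (x ∷ v) = x ∷ fstV n v

  sndV : ∀ n {m} → Vn (n + m) → Vn m
  sndV zero v = v
  sndV (suc n) (x ∷ v) = sndV n v

  fst-++ : ∀ {n m} (a : Vn n) (b : Vn m) → fstV n (a ++ b) ≡ a
  fst-++ [] b = refl
  fst-++ (x ∷ a) b = cong (x ∷_) (fst-++ a b)

  snd-++ : ∀ {n m} (a : Vn n) (b : Vn m) → sndV n (a ++ b) ≡ b
  snd-++ [] b = refl
  snd-++ (x ∷ a) b = snd-++ a b

  fs-++ : ∀ n {m} (v : Vn (n + m)) → fstV n v ++ sndV n v ≡ v
  fs-++ zero v = refl
  fs-++ (suc n) (x ∷ v) = cong (x ∷_) (fs-++ n v)

  splitI : ∀ n {m} → Vn (n + m) ↔ (Vn n × Vn m)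
  splitI n = mk↔ₛ′ (λ v → fstV n v , sndV n v) (λ p → proj₁ p ++ proj₂ p)
    (λ p → cong₂ _,_ (fst-++ (proj₁ p) (proj₂ p)) (snd-++ (proj₁ p) (proj₂ p))) (fs-++ n)

  appI : ∀ n {m} → (Vn n × Vn m) ↔ Vn (n + m)
  appI n = ↔-sym (splitI n)

  Σ-split : ∀ n {m} {Q : Vn n → Vn m → Set} →
            Σ (Vn (n + m)) (λ u → Q (fstV n u) (sndV n u)) ↔ Σ (Vn n × Vn m) (uncurry Q)
  Σ-split n = Σ-↔ (splitI n) ↔-refl

  IdV-split : ∀ n {m} {v w : Vn (n + m)} →
              IdV v w ↔ (IdV (fstV n v) (fstV n w) × IdV (sndV n v) (sndV n w))
  IdV-split zero = unitL
  IdV-split (suc n) {v = x ∷ v} {y ∷ w} = ↔-trans (↔-refl ×-↔ IdV-split n) (↔-sym assocI)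

  IdV-++ : ∀ {n m} (a c : Vn n) (b d : Vn m) → IdV (a ++ b) (c ++ d) ↔ (IdV a c × IdV b d)
  IdV-++ [] [] b d = unitL
  IdV-++ (x ∷ a) (y ∷ c) b d = ↔-trans (↔-refl ×-↔ IdV-++ a c b d) (↔-sym assocI)

  IdV-++ˡ : ∀ {n m} (a : Vn n) (b : Vn m) (w : Vn (n + m)) →
            IdV (a ++ b) w ↔ (IdV a (fstV n w) × IdV b (sndV n w))
  IdV-++ˡ {n} a b w =
    ↔-trans (≡↔ (cong (IdV (a ++ b)) (sym (fs-++ n w)))) (IdV-++ a (fstV n w) b (sndV n w))

  IdV-++ʳ : ∀ {n m} (a : Vn n) (b : Vn m) (w : Vn (n + m)) →
            IdV w (a ++ b) ↔ (IdV (fstV n w) a × IdV (sndV n w) b)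
  IdV-++ʳ {n} a b w =
    ↔-trans (≡↔ (cong (λ u → IdV u (a ++ b)) (sym (fs-++ n w)))) (IdV-++ (fstV n w) a (sndV n w) b)

  -- vectors are equal when their lists are; this absorbs transports along
  -- equations between lengths (toList-subst)
  vecEq : ∀ {n} (v w : Vn n) → toList v ≡ toList w → v ≡ w
  vecEq v w e = trans (sym (cast-is-id refl v)) (toList-injective refl v w e)

  toList-subst : ∀ {n n'} (e : n ≡ n') (v : Vn n) → toList (subst Vn e v) ≡ toList v
  toList-subst refl v = refl

  toList-++³ : ∀ {n m p} (a : Vn n) (b : Vn m) (c : Vn p) →
               toList ((a ++ b) ++ c) ≡ toList (a ++ (b ++ c))
  toList-++³ a b c = begin
    toList ((a ++ b) ++ c)                        ≡⟨ toList-++ (a ++ b) c ⟩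
    toList (a ++ b) List.++ toList c               ≡⟨ cong (List._++ toList c) (toList-++ a b) ⟩
    (toList a List.++ toList b) List.++ toList c   ≡⟨ ListP.++-assoc (toList a) (toList b) (toList c) ⟩
    toList a List.++ (toList b List.++ toList c)   ≡⟨ cong (toList a List.++_) (toList-++ b c) ⟨
    toList a List.++ toList (b ++ c)               ≡⟨ toList-++ a (b ++ c) ⟨
    toList (a ++ (b ++ c))                         ∎
    where open ≡-Reasoning

  reassocL : ∀ {n m p} (e : n + (m + p) ≡ (n + m) + p) (a : Vn n) (b : Vn m) (c : Vn p) →
             subst Vn e (a ++ (b ++ c)) ≡ (a ++ b) ++ c
  reassocL e a b c = vecEq _ _ (trans (toList-subst e _) (sym (toList-++³ a b c)))

  reassocR : ∀ {n m p} (e : (n + m) + p ≡ n + (m + p)) (a : Vn n) (b : Vn m) (c : Vn p) →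
             subst Vn e ((a ++ b) ++ c) ≡ a ++ (b ++ c)
  reassocR e a b c = vecEq _ _ (trans (toList-subst e _) (toList-++³ a b c))

  ext3 : ∀ {n m p} {Y : Set} (f g : Vn (n + (m + p)) → Y) →
         (∀ a b c → f (a ++ (b ++ c)) ≡ g (a ++ (b ++ c))) → ∀ v → f v ≡ g v
  ext3 {n} {m} {p} f g h v = subst (λ u → f u ≡ g u) decomp
    (h (fstV n v) (fstV m (sndV n v)) (sndV m (sndV n v)))
    where
    decomp : fstV n v ++ (fstV m (sndV n v) ++ sndV m (sndV n v)) ≡ v
    decomp = trans (cong (fstV n v ++_) (fs-++ m (sndV n v))) (fs-++ n v)

  ext3' : ∀ {n m p} {Y : Set} (f g : Vn ((n + m) + p) → Y) →
          (∀ a b c → f ((a ++ b) ++ c) ≡ g ((a ++ b) ++ c)) → ∀ v → f v ≡ g v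
  ext3' {n} {m} {p} f g h v = subst (λ u → f u ≡ g u) decomp
    (h (fstV n (fstV (n + m) v)) (sndV n (fstV (n + m) v)) (sndV (n + m) v))
    where
    decomp : (fstV n (fstV (n + m) v) ++ sndV n (fstV (n + m) v)) ++ sndV (n + m) v ≡ v
    decomp = trans (cong (_++ sndV (n + m) v) (fs-++ n (fstV (n + m) v))) (fs-++ (n + m) v)

  FunV : ∀ {X : Set} {m} → (X → Vn m) → Fam X (Vn m)
  FunV f x w = IdV (f x) w

  coFunV : ∀ {X : Set} {m} → (X → Vn m) → Fam (Vn m) X
  coFunV f w x = IdV w (f x)

  FunV-⊙ : ∀ {X : Set} {n m} (f : X → Vn n) (g : Vn n → Vn m) → FunV f ⊙ FunV g ≈F FunV (g ∘ f)
  FunV-⊙ f g x w = IdV-contrR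

  FunV-⊙R : ∀ {X Z : Set} {n} (f : X → Vn n) (R : Fam (Vn n) Z) → FunV f ⊙ R ≈F (λ x z → R (f x) z)
  FunV-⊙R f R x z = IdV-contrR

  ⊙-coFunV : ∀ {X Z : Set} {n} (R : Fam X (Vn n)) (f : Z → Vn n) → R ⊙ coFunV f ≈F (λ x z → R x (f z))
  ⊙-coFunV R f x z = ↔-trans (Σ-↔ ↔-refl (×-comm _ _)) IdV-contrL

  FunV-ext : ∀ {X : Set} {m} {f g : X → Vn m} → (∀ x → f x ≡ g x) → FunV f ≈F FunV g
  FunV-ext e x w = ≡↔ (cong (λ u → IdV u w) (e x))

  coFunV-ext : ∀ {X : Set} {m} {f g : X → Vn m} → (∀ x → f x ≡ g x) → coFunV f ≈F coFunV g
  coFunV-ext e w x = ≡↔ (cong (IdV w) (e x))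

  spanOf-FunV : ∀ {X : Set} {m} (f : X → Vn m) → spanOf (FunV f) ≅ graph f
  spanOf-FunV {X} f = mk≅ (mk↔ₛ′ (λ z → proj₁ (proj₁ z)) (λ x → (x , f x) , reflV (f x)) (λ _ → refl) gf)
    (λ _ → refl) (λ z → IdV⇒≡ (proj₂ z))
    where
    gf : ∀ z → ((proj₁ (proj₁ z) , f (proj₁ (proj₁ z))) , reflV (f (proj₁ (proj₁ z)))) ≡ z
    gf ((x , w) , q) = cong (λ (p : Σ _ (IdV (f x))) → (x , proj₁ p) , proj₂ p) (IdV-singl q)

  spanOf-coFunV : ∀ {X : Set} {m} (f : X → Vn m) → spanOf (coFunV f) ≅ span X f id
  spanOf-coFunV {X} f = mk≅ (mk↔ₛ′ (λ z → proj₂ (proj₁ z)) (λ x → (f x , x) , reflV (f x)) (λ _ → refl) gf)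
    (λ z → sym (IdV⇒≡ (proj₂ z))) (λ _ → refl)
    where
    gf : ∀ z → ((f (proj₂ (proj₁ z)) , proj₂ (proj₁ z)) , reflV (f (proj₂ (proj₁ z)))) ≡ z
    gf ((w , x) , q) = cong (λ (p : Σ _ (λ u → IdV u (f x))) → (proj₁ p , x) , proj₂ p) (IdV-singl' q)

  spanOf-≈Fun : ∀ {X : Set} {m} {R : Fam X (Vn m)} (f : X → Vn m) → R ≈F FunV f → spanOf R ≅ graph f
  spanOf-≈Fun f e = ≅trans (spanOf-cong e) (spanOf-FunV f)

  spanOf-≈coFun : ∀ {X : Set} {m} {R : Fam (Vn m) X} (f : X → Vn m) → R ≈F coFunV f → spanOf R ≅ span X f id
  spanOf-≈coFun f e = ≅trans (spanOf-cong e) (spanOf-coFunV f)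

module Semantics (S : Signature) (G : Hypergraph S) where

  open Signature S
  open Hypergraph G
  open Vectors V public

  infixl 6 _⊕F_
  _⊕F_ : ∀ {n m p q} → Fam (Vn n) (Vn m) → Fam (Vn p) (Vn q) → Fam (Vn (n + p)) (Vn (m + q))
  _⊕F_ {n} {m} R T v w = R (fstV n v) (fstV m w) × T (sndV n v) (sndV m w)

  rot : ∀ n m → Vn (n + m) → Vn (m + n)
  rot n m v = sndV n v ++ fstV n v

  dup : ∀ {n} → Vn n → Vn (n + n)
  dup v = v ++ v

  ⟦_⟧ : ∀ {n m} → Term S n m → Fam (Vn n) (Vn m)
  ⟦ δ ⟧ = FunV dup
  ⟦ ε ⟧ = λ _ _ → ⊤
  ⟦ μ ⟧ = coFunV dup
  ⟦ η ⟧ = λ _ _ → ⊤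
  ⟦ id₀ ⟧ = IdV
  ⟦ id₁ ⟧ = IdV
  ⟦ σ ⟧ = FunV (rot 1 1)
  ⟦ gen R ⟧ v w = Σ (E R) λ e → IdV (src e) v × IdV (tgt e) w
  ⟦ c ⨾ d ⟧ = ⟦ c ⟧ ⊙ ⟦ d ⟧
  ⟦ c ⊕ d ⟧ = ⟦ c ⟧ ⊕F ⟦ d ⟧

  ⊕F-cong : ∀ {n m p q} {R R' : Fam (Vn n) (Vn m)} {T T' : Fam (Vn p) (Vn q)} →
            R ≈F R' → T ≈F T' → R ⊕F T ≈F R' ⊕F T'
  ⊕F-cong e e' v w = e _ _ ×-↔ e' _ _

  spanOf-⊕F : ∀ {n m p q} (R : Fam (Vn n) (Vn m)) (T : Fam (Vn p) (Vn q)) →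
              span (apex (spanOf (R ⊕F T))) (from (appI n) ∘ lft (spanOf (R ⊕F T)))
                                            (from (appI m) ∘ rgt (spanOf (R ⊕F T)))
              ≅ spanOf R ⊗ˢ spanOf T
  spanOf-⊕F {n} {m} {p} {q} R T =
    mk≅ (↔-trans (Σ-↔ (splitI n ×-↔ splitI m) ↔-refl) regroup) (λ _ → refl) (λ _ → refl)
    where
    regroup : Σ ((Vn n × Vn p) × (Vn m × Vn q))
                (λ z → R (proj₁ (proj₁ z)) (proj₁ (proj₂ z)) × T (proj₂ (proj₁ z)) (proj₂ (proj₂ z)))
              ↔ (apex (spanOf R) × apex (spanOf T))
    regroup = mk↔ₛ′ (λ { (((a , b) , (x , y)) , r , s) → ((a , x) , r) , ((b , y) , s) })
                    (λ { (((a , x) , r) , ((b , y) , s)) → (((a , b) , (x , y)) , r , s) })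
                    (λ _ → refl) (λ _ → refl)

  FunV-⊕ : ∀ {n m p q} (f : Vn n → Vn m) (g : Vn p → Vn q) →
           FunV f ⊕F FunV g ≈F FunV (λ v → f (fstV n v) ++ g (sndV n v))
  FunV-⊕ f g v w = ↔-sym (IdV-++ˡ _ _ w)

  coFunV-⊕ : ∀ {n m p q} (f : Vn m → Vn n) (g : Vn q → Vn p) →
             coFunV f ⊕F coFunV g ≈F coFunV (λ w → f (fstV m w) ++ g (sndV m w))
  coFunV-⊕ f g v w = ↔-sym (IdV-++ʳ _ _ v)

  castSem : ∀ {n n' m m'} (p : n ≡ n') (q : m ≡ m') (c : Term S n m) v w →
            ⟦ cast p q c ⟧ v w ≡ ⟦ c ⟧ (subst Vn (sym p) v) (subst Vn (sym q) w)
  castSem refl refl c v w = refl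

  IdV-substJ : ∀ {m m'} (e : m ≡ m') {a : Vn m} {w : Vn m'} →
               IdV a (subst Vn (sym e) w) ↔ IdV (subst Vn e a) w
  IdV-substJ refl = ↔-refl

  castFunV : ∀ {n n' m m'} (p : n ≡ n') (q : m ≡ m') (c : Term S n m) (h : Vn n → Vn m) →
             ⟦ c ⟧ ≈F FunV h → ⟦ cast p q c ⟧ ≈F FunV (λ v → subst Vn q (h (subst Vn (sym p) v)))
  castFunV p q c h e v w = ↔-trans (≡↔ (castSem p q c v w)) (↔-trans (e _ _) (IdV-substJ q))

  idₙ-sem : ∀ n → ⟦ idₙ {S} n ⟧ ≈F FunV id
  idₙ-sem zero = ≈Frefl
  idₙ-sem (suc n) (x ∷ v) (y ∷ w) = ↔-sym unitR ×-↔ idₙ-sem n v w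

  ε-sem : ⟦ ε {S} ⟧ ≈F FunV (λ _ → [])
  ε-sem v [] = ↔-refl

  η-sem : ⟦ η {S} ⟧ ≈F coFunV (λ _ → [])
  η-sem [] w = ↔-refl

  εₙ-sem : ∀ n → ⟦ εₙ {S} n ⟧ ≈F FunV (λ _ → [])
  εₙ-sem zero [] [] = ↔-refl
  εₙ-sem (suc n) v [] = ↔-trans (↔-refl ×-↔ εₙ-sem n _ []) (↔-sym unitR)

  ηₙ-sem : ∀ n → ⟦ ηₙ {S} n ⟧ ≈F coFunV (λ _ → [])
  ηₙ-sem zero [] [] = ↔-refl
  ηₙ-sem (suc n) [] w = ↔-trans (↔-refl ×-↔ ηₙ-sem n [] _) (↔-sym unitR)

  rot-inv : ∀ n m (v : Vn (n + m)) → rot m n (rot n m v) ≡ v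
  rot-inv n m v rewrite snd-++ (sndV n v) (fstV n v) | fst-++ (sndV n v) (fstV n v) = fs-++ n v

  IdV-rot : ∀ n m {v : Vn (n + m)} {w : Vn (m + n)} → IdV (rot n m v) w ↔ IdV (rot m n w) v
  IdV-rot n m {v} {w} = IdV-propI (λ e → trans (cong (rot m n) (sym e)) (rot-inv n m v))
                                  (λ e → trans (cong (rot n m) (sym e)) (rot-inv m n w))

  snoc-assoc : ∀ {k l} (b : Vn k) x (a : Vn l) → toList ((b ++ (x ∷ [])) ++ a) ≡ toList (b ++ (x ∷ a))
  snoc-assoc [] x a = refl
  snoc-assoc (y ∷ b) x a = cong (y List.∷_) (snoc-assoc b x a)

  σ₁-sem : ∀ m → ⟦ σ₁ {S} m ⟧ ≈F FunV (rot 1 m)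
  σ₁-sem zero (x ∷ []) w = ↔-refl
  σ₁-sem (suc m) =
    ≈Ftrans (⊙-cong (⊕F-cong {R = ⟦ σ ⟧} ≈Frefl (idₙ-sem m)) (⊕F-cong {R = ⟦ id₁ ⟧} ≈Frefl (σ₁-sem m)))
    (≈Ftrans (⊙-cong (FunV-⊕ (rot 1 1) id) (FunV-⊕ id (rot 1 m)))
    (≈Ftrans (FunV-⊙ _ _) (FunV-ext λ { (x ∷ y ∷ r) → refl })))

  σₙ-sem : ∀ n m → ⟦ σₙ {S} n m ⟧ ≈F FunV (rot n m)
  σₙ-sem zero m = ≈Ftrans (castFunV refl (sym (+-identityʳ m)) (idₙ m) id (idₙ-sem m))
    (FunV-ext λ v → vecEq _ _ (trans (toList-subst _ v) (sym (trans (toList-++ v []) (ListP.++-identityʳ _)))))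
  σₙ-sem (suc n) m =
    ≈Ftrans (⊙-cong (≈Ftrans (⊕F-cong {R = ⟦ id₁ ⟧} ≈Frefl (σₙ-sem n m)) (FunV-⊕ id (rot n m)))
                    (castFunV refl (+-assoc m 1 n) (σ₁ m ⊕ idₙ n) _
                       (≈Ftrans (⊕F-cong (σ₁-sem m) (idₙ-sem n)) (FunV-⊕ (rot 1 m) id))))
    (≈Ftrans (FunV-⊙ _ _) (FunV-ext λ { (x ∷ v) →
      vecEq _ _ (trans (toList-subst (+-assoc m 1 n) _) (rotated x (sndV n v) (fstV n v))) }))
    where
    rotated : ∀ x (b : Vn m) (a : Vn n) →
              toList (rot 1 m (x ∷ fstV m (b ++ a)) ++ sndV m (b ++ a)) ≡ toList (b ++ (x ∷ a))
    rotated x b a rewrite fst-++ b a | snd-++ b a = snoc-assoc b x a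

  δₙ-sem : ∀ n → ⟦ δₙ {S} n ⟧ ≈F FunV dup
  δₙ-sem zero [] [] = ↔-refl
  δₙ-sem (suc n) =
    ≈Ftrans (⊙-cong (≈Ftrans (⊕F-cong {R = ⟦ δ ⟧} ≈Frefl (δₙ-sem n)) (FunV-⊕ {1} {2} {n} {n + n} dup dup))
                    (castFunV refl (+-assoc (suc n) 1 n) (id₁ ⊕ (σₙ 1 n ⊕ idₙ n)) _ interleave-sem))
    (≈Ftrans (FunV-⊙ _ _) (FunV-ext λ { (x ∷ v) →
      vecEq _ _ (trans (toList-subst (+-assoc (suc n) 1 n) _) (cong (x List.∷_) (interleaving x v))) }))
    where
    interleave-sem : ⟦ id₁ {S} ⊕ (σₙ 1 n ⊕ idₙ n) ⟧ ≈F
                     FunV (λ u → fstV 1 u ++ (rot 1 n (fstV (suc n) (sndV 1 u)) ++ sndV (suc n) (sndV 1 u)))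
    interleave-sem =
      ≈Ftrans (⊕F-cong {R = ⟦ id₁ ⟧} ≈Frefl
                (≈Ftrans (⊕F-cong (σₙ-sem 1 n) (idₙ-sem n)) (FunV-⊕ {suc n} {n + 1} {n} {n} (rot 1 n) id)))
              (FunV-⊕ {1} {1} {suc n + n} {n + 1 + n} id (λ u → rot 1 n (fstV (suc n) u) ++ sndV (suc n) u))
    interleaving : ∀ x (v : Vn n) →
                  toList (rot 1 n (x ∷ fstV n (v ++ v)) ++ sndV n (v ++ v)) ≡ toList (v ++ (x ∷ v))
    interleaving x v rewrite fst-++ v v | snd-++ v v = snoc-assoc v x v

  -- μₙ is built as the mirror image of δₙ, hence denotes the converse relation
  μₙ-transpose : ∀ n → ⟦ μₙ {S} n ⟧ ≈F transpose ⟦ δₙ {S} n ⟧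
  μₙ-transpose zero v w = IdV-symI
  μₙ-transpose (suc n) v w =
    ↔-trans (Σ-↔ ↔-refl (λ {u} → shuffle u ×-↔ blocks u)) (Σ-↔ ↔-refl (×-comm _ _))
    where
    e = +-assoc (suc n) 1 n
    mirror : ∀ (a : Vn (1 + ((n + 1) + n))) (u : Vn (1 + ((1 + n) + n))) →
             ⟦ id₁ {S} ⊕ (σₙ n 1 ⊕ idₙ n) ⟧ a u ↔ ⟦ id₁ {S} ⊕ (σₙ 1 n ⊕ idₙ n) ⟧ u a
    mirror a u = IdV-symI ×-↔ (↔-trans (σₙ-sem n 1 _ _) (↔-trans (IdV-rot n 1) (↔-sym (σₙ-sem 1 n _ _)))
                               ×-↔ ↔-trans (idₙ-sem n _ _) (↔-trans IdV-symI (↔-sym (idₙ-sem n _ _))))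
    shuffle : ∀ u → ⟦ cast e refl (id₁ ⊕ (σₙ n 1 ⊕ idₙ n)) ⟧ v u ↔ ⟦ cast refl e (id₁ ⊕ (σₙ 1 n ⊕ idₙ n)) ⟧ u v
    shuffle u = ↔-trans (≡↔ (castSem e refl (id₁ ⊕ (σₙ n 1 ⊕ idₙ n)) v u))
                (↔-trans (mirror _ _) (↔-sym (≡↔ (castSem refl e (id₁ ⊕ (σₙ 1 n ⊕ idₙ n)) u v))))
    blocks : ∀ u → (⟦ μ {S} ⟧ ⊕F ⟦ μₙ {S} n ⟧) u w ↔ (⟦ δ {S} ⟧ ⊕F ⟦ δₙ {S} n ⟧) w u
    blocks u = IdV-symI ×-↔ μₙ-transpose n _ _

  μₙ-sem : ∀ n → ⟦ μₙ {S} n ⟧ ≈F coFunV dup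
  μₙ-sem n v w = ↔-trans (μₙ-transpose n v w) (↔-trans (δₙ-sem n w v) IdV-symI)

  sem-⨾-idˡ : ∀ {n m} (c : Term S n m) → ⟦ idₙ n ⨾ c ⟧ ≈F ⟦ c ⟧
  sem-⨾-idˡ {n} c = ≈Ftrans (⊙-cong (idₙ-sem n) ≈Frefl) (FunV-⊙R id ⟦ c ⟧)

  sem-⨾-idʳ : ∀ {n m} (c : Term S n m) → ⟦ c ⨾ idₙ m ⟧ ≈F ⟦ c ⟧
  sem-⨾-idʳ {n} {m} c = ≈Ftrans (⊙-cong ≈Frefl (idₙ-sem m)) (⊙-coFunV ⟦ c ⟧ id)

  sem-⊕-idˡ : ∀ {n m} (c : Term S n m) → ⟦ id₀ ⊕ c ⟧ ≈F ⟦ c ⟧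
  sem-⊕-idˡ c v w = ↔-sym unitL

  sem-⊕-idʳ : ∀ {n m} (c : Term S n m) →
            ⟦ c ⊕ id₀ ⟧ ≈F ⟦ cast (sym (+-identityʳ n)) (sym (+-identityʳ m)) c ⟧
  sem-⊕-idʳ {n} {m} c v w =
    ↔-trans (↔-refl ×-↔ IdV0 _ _) (↔-trans (↔-sym unitR)
    (↔-trans (subst2I ⟦ c ⟧ (unpad n v) (unpad m w)) (↔-sym (≡↔ (castSem _ _ c v w)))))
    where
    unpad : ∀ k (u : Vn (k + 0)) → fstV k u ≡ subst Vn (sym (sym (+-identityʳ k))) u
    unpad k u = vecEq _ _ (sym (trans (toList-subst _ u)
      (trans (cong toList (sym (fs-++ k u))) (trans (toList-++ (fstV k u) (sndV k u))
        (trans (cong (toList (fstV k u) List.++_) (toList-empty (sndV k u))) (ListP.++-identityʳ _))))))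
      where
      toList-empty : (z : Vn 0) → toList z ≡ List.[]
      toList-empty [] = refl

  sem-⊕-id : ∀ n m → ⟦ idₙ {S} n ⊕ idₙ m ⟧ ≈F ⟦ idₙ (n + m) ⟧
  sem-⊕-id n m = ≈Ftrans (⊕F-cong (idₙ-sem n) (idₙ-sem m))
               (≈Ftrans (λ v w → ↔-sym (IdV-split n)) (≈Fsym (idₙ-sem (n + m))))

  sem-interchange : ∀ {n z m p y q} (c : Term S n z) (d : Term S z m) (c' : Term S p y) (d' : Term S y q) →
                  ⟦ (c ⨾ d) ⊕ (c' ⨾ d') ⟧ ≈F ⟦ (c ⊕ c') ⨾ (d ⊕ d') ⟧
  sem-interchange {n} {z} {m} {p} {y} {q} c d c' d' v w =
    ↔-sym (↔-trans (Σ-split z) shuffle)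
    where
    shuffle : Σ (Vn z × Vn y) (λ ab → (⟦ c ⟧ (fstV n v) (proj₁ ab) × ⟦ c' ⟧ (sndV n v) (proj₂ ab)) ×
                                       (⟦ d ⟧ (proj₁ ab) (fstV m w) × ⟦ d' ⟧ (proj₂ ab) (sndV m w)))
              ↔ ((⟦ c ⟧ ⊙ ⟦ d ⟧) (fstV n v) (fstV m w) × (⟦ c' ⟧ ⊙ ⟦ d' ⟧) (sndV n v) (sndV m w))
    shuffle = mk↔ₛ′ (λ { ((a , b) , (r , r') , (s , s')) → (a , r , s) , (b , r' , s') })
                    (λ { ((a , r , s) , (b , r' , s')) → ((a , b) , (r , r') , (s , s')) })
                    (λ _ → refl) (λ _ → refl)

  sem-σ-inv : ∀ n m → ⟦ σₙ {S} n m ⨾ σₙ m n ⟧ ≈F ⟦ idₙ (n + m) ⟧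
  sem-σ-inv n m = ≈Ftrans (⊙-cong (σₙ-sem n m) (σₙ-sem m n))
                (≈Ftrans (FunV-⊙ _ _) (≈Ftrans (FunV-ext (rot-inv n m)) (≈Fsym (idₙ-sem (n + m)))))

  sem-σ-nat : ∀ {n m p q} (c : Term S n m) (d : Term S p q) →
            ⟦ (c ⊕ d) ⨾ σₙ m q ⟧ ≈F ⟦ σₙ n p ⨾ (d ⊕ c) ⟧
  sem-σ-nat {n} {m} {p} {q} c d v w =
    ↔-trans (Σ-↔ ↔-refl (↔-refl ×-↔ ↔-trans (σₙ-sem m q _ _) (↔-trans (IdV-rot m q) IdV-symI)))
    (↔-trans (⊙-coFunV (⟦ c ⟧ ⊕F ⟦ d ⟧) (rot q m) v w)
    (↔-trans (subst2I ⟦ c ⟧ refl (fst-++ (sndV q w) (fstV q w)) ×-↔ subst2I ⟦ d ⟧ refl (snd-++ (sndV q w) (fstV q w)))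
    (↔-trans (×-comm _ _)
    (↔-sym (↔-trans (Σ-↔ ↔-refl (σₙ-sem n p _ _ ×-↔ ↔-refl))
           (↔-trans (FunV-⊙R (rot n p) (⟦ d ⟧ ⊕F ⟦ c ⟧) v w)
           (subst2I ⟦ d ⟧ (fst-++ (sndV n v) (fstV n v)) refl ×-↔ subst2I ⟦ c ⟧ (snd-++ (sndV n v) (fstV n v)) refl)))))))

  module _ {n p r : ℕ} (e : (n + p) + r ≡ n + (p + r)) where
    block₁ : ∀ v → fstV n (subst Vn e v) ≡ fstV n (fstV (n + p) v)
    block₁ = ext3' {n} {p} {r} _ _ λ a b c → trans (cong (fstV n) (reassocR e a b c))
           (trans (fst-++ a (b ++ c)) (sym (trans (cong (fstV n) (fst-++ (a ++ b) c)) (fst-++ a b))))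
    block₂ : ∀ v → fstV p (sndV n (subst Vn e v)) ≡ sndV n (fstV (n + p) v)
    block₂ = ext3' {n} {p} {r} _ _ λ a b c → trans (cong (λ u → fstV p (sndV n u)) (reassocR e a b c))
           (trans (cong (fstV p) (snd-++ a (b ++ c))) (trans (fst-++ b c)
             (sym (trans (cong (sndV n) (fst-++ (a ++ b) c)) (snd-++ a b)))))
    block₃ : ∀ v → sndV p (sndV n (subst Vn e v)) ≡ sndV (n + p) v
    block₃ = ext3' {n} {p} {r} _ _ λ a b c → trans (cong (λ u → sndV p (sndV n u)) (reassocR e a b c))
           (trans (cong (sndV p) (snd-++ a (b ++ c))) (trans (snd-++ b c) (sym (snd-++ (a ++ b) c))))

  sem-⊕-assoc : ∀ {n m p q r s} (c : Term S n m) (d : Term S p q) (e : Term S r s) →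
              ⟦ (c ⊕ d) ⊕ e ⟧ ≈F ⟦ cast (sym (+-assoc n p r)) (sym (+-assoc m q s)) (c ⊕ (d ⊕ e)) ⟧
  sem-⊕-assoc {n} {m} {p} {q} {r} {s} c d e v w =
    ↔-trans assocI (↔-trans
      (subst2I ⟦ c ⟧ (sym (block₁ {n} {p} {r} e1 v)) (sym (block₁ {m} {q} {s} e2 w)) ×-↔
        (subst2I ⟦ d ⟧ (sym (block₂ {n} {p} {r} e1 v)) (sym (block₂ {m} {q} {s} e2 w)) ×-↔
         subst2I ⟦ e ⟧ (sym (block₃ {n} {p} {r} e1 v)) (sym (block₃ {m} {q} {s} e2 w))))
      (↔-sym (≡↔ (castSem _ _ (c ⊕ (d ⊕ e)) v w))))
    where
    e1 = sym (sym (+-assoc n p r))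
    e2 = sym (sym (+-assoc m q s))

  rot-++ : ∀ {n m} (a : Vn n) (b : Vn m) → rot n m (a ++ b) ≡ b ++ a
  rot-++ a b = cong₂ _++_ (snd-++ a b) (fst-++ a b)

  apL : ∀ {k k' l} (f : Vn k → Vn k') (x : Vn k) (y : Vn l) → f (fstV k (x ++ y)) ++ sndV k (x ++ y) ≡ f x ++ y
  apL f x y = cong₂ _++_ (cong f (fst-++ x y)) (snd-++ x y)

  apR : ∀ {k l l'} (g : Vn l → Vn l') (x : Vn k) (y : Vn l) → fstV k (x ++ y) ++ g (sndV k (x ++ y)) ≡ x ++ g y
  apR g x y = cong₂ _++_ (fst-++ x y) (cong g (snd-++ x y))

  sem-σ-hexˡ : ∀ n m p → ⟦ σₙ {S} n (m + p) ⟧ ≈F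
             ⟦ cast refl (sym (+-assoc m p n))
                 (cast (+-assoc n m p) (+-assoc m n p) (σₙ n m ⊕ idₙ p) ⨾ (idₙ m ⊕ σₙ n p)) ⟧
  sem-σ-hexˡ n m p =
    ≈Ftrans (σₙ-sem n (m + p))
    (≈Fsym (≈Ftrans (castFunV refl e0 _ _
      (≈Ftrans (⊙-cong (castFunV e1 e2 _ rotFront
                          (≈Ftrans (⊕F-cong (σₙ-sem n m) (idₙ-sem p)) (FunV-⊕ {n + m} {m + n} {p} {p} (rot n m) id)))
                       (≈Ftrans (⊕F-cong (idₙ-sem m) (σₙ-sem n p)) (FunV-⊕ {m} {m} {n + p} {p + n} id (rot n p))))
               (FunV-⊙ _ _)))
      (FunV-ext (ext3 {n} {m} {p} _ _ on-blocks))))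
    where
    e0 = sym (+-assoc m p n)
    e1 = +-assoc n m p
    e2 = +-assoc m n p
    rotFront : Vn ((n + m) + p) → Vn ((m + n) + p)
    rotFront u = rot n m (fstV (n + m) u) ++ sndV (n + m) u
    rotBack : Vn (m + (n + p)) → Vn (m + p + n)
    rotBack t = subst Vn e0 (fstV m t ++ rot n p (sndV m t))
    on-blocks : ∀ (a : Vn n) (b : Vn m) (c : Vn p) →
                rotBack (subst Vn e2 (rotFront (subst Vn (sym e1) (a ++ (b ++ c))))) ≡ rot n (m + p) (a ++ (b ++ c))
    on-blocks a b c = begin
      rotBack (subst Vn e2 (rotFront (subst Vn (sym e1) (a ++ (b ++ c)))))
        ≡⟨ cong (λ t → rotBack (subst Vn e2 (rotFront t))) (reassocL (sym e1) a b c) ⟩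
      rotBack (subst Vn e2 (rotFront ((a ++ b) ++ c)))
        ≡⟨ cong (λ t → rotBack (subst Vn e2 t)) (trans (apL (rot n m) (a ++ b) c) (cong (_++ c) (rot-++ a b))) ⟩
      rotBack (subst Vn e2 ((b ++ a) ++ c))
        ≡⟨ cong rotBack (reassocR e2 b a c) ⟩
      rotBack (b ++ (a ++ c))
        ≡⟨ cong (subst Vn e0) (trans (apR (rot n p) b (a ++ c)) (cong (b ++_) (rot-++ a c))) ⟩
      subst Vn e0 (b ++ (c ++ a))
        ≡⟨ reassocL e0 b c a ⟩
      (b ++ c) ++ a
        ≡⟨ rot-++ a (b ++ c) ⟨
      rot n (m + p) (a ++ (b ++ c)) ∎
      where open ≡-Reasoning

  sem-σ-hexʳ : ∀ n m p → ⟦ σₙ {S} (n + m) p ⟧ ≈F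
             ⟦ cast (sym (+-assoc n m p)) refl
                 ((idₙ n ⊕ σₙ m p) ⨾ cast (+-assoc n p m) (+-assoc p n m) (σₙ n p ⊕ idₙ m)) ⟧
  sem-σ-hexʳ n m p =
    ≈Ftrans (σₙ-sem (n + m) p)
    (≈Fsym (≈Ftrans (castFunV (sym e1) refl _ _
      (≈Ftrans (⊙-cong (≈Ftrans (⊕F-cong (idₙ-sem n) (σₙ-sem m p)) (FunV-⊕ {n} {n} {m + p} {p + m} id (rot m p)))
                       (castFunV e3 e4 _ rotFront
                          (≈Ftrans (⊕F-cong (σₙ-sem n p) (idₙ-sem m)) (FunV-⊕ {n + p} {p + n} {m} {m} (rot n p) id))))
               (FunV-⊙ _ _)))
      (FunV-ext (ext3' {n} {m} {p} _ _ on-blocks))))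
    where
    e1 = +-assoc n m p
    e3 = +-assoc n p m
    e4 = +-assoc p n m
    rotFront : Vn ((n + p) + m) → Vn ((p + n) + m)
    rotFront u = rot n p (fstV (n + p) u) ++ sndV (n + p) u
    rotBack : Vn (n + (m + p)) → Vn (n + (p + m))
    rotBack u = fstV n u ++ rot m p (sndV n u)
    on-blocks : ∀ (a : Vn n) (b : Vn m) (c : Vn p) →
                subst Vn e4 (rotFront (subst Vn (sym e3) (rotBack (subst Vn (sym (sym e1)) ((a ++ b) ++ c)))))
                ≡ rot (n + m) p ((a ++ b) ++ c)
    on-blocks a b c = begin
      subst Vn e4 (rotFront (subst Vn (sym e3) (rotBack (subst Vn (sym (sym e1)) ((a ++ b) ++ c)))))
        ≡⟨ cong (λ t → subst Vn e4 (rotFront (subst Vn (sym e3) (rotBack t)))) (reassocR (sym (sym e1)) a b c) ⟩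
      subst Vn e4 (rotFront (subst Vn (sym e3) (rotBack (a ++ (b ++ c)))))
        ≡⟨ cong (λ t → subst Vn e4 (rotFront (subst Vn (sym e3) t)))
                (trans (apR (rot m p) a (b ++ c)) (cong (a ++_) (rot-++ b c))) ⟩
      subst Vn e4 (rotFront (subst Vn (sym e3) (a ++ (c ++ b))))
        ≡⟨ cong (λ t → subst Vn e4 (rotFront t)) (reassocL (sym e3) a c b) ⟩
      subst Vn e4 (rotFront ((a ++ c) ++ b))
        ≡⟨ cong (subst Vn e4) (trans (apL (rot n p) (a ++ c) b) (cong (_++ b) (rot-++ a c))) ⟩
      subst Vn e4 ((c ++ a) ++ b)
        ≡⟨ reassocR e4 c a b ⟩
      c ++ (a ++ b)
        ≡⟨ rot-++ (a ++ b) c ⟨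
      rot (n + m) p ((a ++ b) ++ c) ∎
      where open ≡-Reasoning

  sem-δ-coassoc : ⟦ δ {S} ⨾ (δ ⊕ id₁) ⟧ ≈F ⟦ δ ⨾ (id₁ ⊕ δ) ⟧
  sem-δ-coassoc = ≈Ftrans (⊙-cong ≈Frefl (FunV-⊕ {1} {2} {1} {1} dup id)) (≈Ftrans (FunV-⊙ _ _)
    (≈Fsym (≈Ftrans (⊙-cong ≈Frefl (FunV-⊕ {1} {1} {1} {2} id dup)) (≈Ftrans (FunV-⊙ _ _)
    (FunV-ext λ { (x ∷ []) → refl })))))

  sem-δ-counitˡ : ⟦ δ {S} ⨾ (ε ⊕ id₁) ⟧ ≈F ⟦ id₁ {S} ⟧
  sem-δ-counitˡ = ≈Ftrans (⊙-cong ≈Frefl (≈Ftrans (⊕F-cong {T = IdV} ε-sem ≈Frefl) (FunV-⊕ {1} {0} {1} {1} (λ _ → []) id)))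
    (≈Ftrans (FunV-⊙ _ _) (FunV-ext λ { (x ∷ []) → refl }))

  sem-δ-counitʳ : ⟦ δ {S} ⨾ (id₁ ⊕ ε) ⟧ ≈F ⟦ id₁ {S} ⟧
  sem-δ-counitʳ = ≈Ftrans (⊙-cong ≈Frefl (≈Ftrans (⊕F-cong {R = IdV} ≈Frefl ε-sem) (FunV-⊕ {1} {1} {1} {0} id (λ _ → []))))
    (≈Ftrans (FunV-⊙ _ _) (FunV-ext λ { (x ∷ []) → refl }))

  sem-δ-comm : ⟦ δ {S} ⨾ σ ⟧ ≈F ⟦ δ {S} ⟧
  sem-δ-comm = ≈Ftrans (FunV-⊙ _ _) (FunV-ext λ { (x ∷ []) → refl })

  sem-μ-assoc : ⟦ (μ {S} ⊕ id₁) ⨾ μ ⟧ ≈F ⟦ (id₁ ⊕ μ) ⨾ μ ⟧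
  sem-μ-assoc = ≈Ftrans (⊙-cong (coFunV-⊕ {2} {1} {1} {1} dup id) ≈Frefl) (≈Ftrans (⊙-coFunV _ _)
    (≈Fsym (≈Ftrans (⊙-cong (coFunV-⊕ {1} {1} {2} {1} id dup) ≈Frefl) (≈Ftrans (⊙-coFunV _ _)
    (coFunV-ext λ { (x ∷ []) → refl })))))

  sem-μ-unitˡ : ⟦ (η {S} ⊕ id₁) ⨾ μ ⟧ ≈F ⟦ id₁ {S} ⟧
  sem-μ-unitˡ = ≈Ftrans (⊙-cong (≈Ftrans (⊕F-cong {T = IdV} η-sem ≈Frefl) (coFunV-⊕ {0} {1} {1} {1} (λ _ → []) id)) ≈Frefl)
    (≈Ftrans (⊙-coFunV _ _) (coFunV-ext λ { (x ∷ []) → refl }))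

  sem-μ-unitʳ : ⟦ (id₁ ⊕ η {S}) ⨾ μ ⟧ ≈F ⟦ id₁ {S} ⟧
  sem-μ-unitʳ = ≈Ftrans (⊙-cong (≈Ftrans (⊕F-cong {R = IdV} ≈Frefl η-sem) (coFunV-⊕ {1} {1} {0} {1} id (λ _ → []))) ≈Frefl)
    (≈Ftrans (⊙-coFunV _ _) (coFunV-ext λ { (x ∷ []) → refl }))

  sem-μ-comm : ⟦ σ {S} ⨾ μ ⟧ ≈F ⟦ μ {S} ⟧
  sem-μ-comm = ≈Ftrans (FunV-⊙R _ ⟦ μ ⟧) λ { (x ∷ y ∷ []) (z ∷ []) → IdV-propI (λ { refl → refl }) (λ { refl → refl }) }

  sem-frobˡ : ⟦ (δ {S} ⊕ id₁) ⨾ (id₁ ⊕ μ) ⟧ ≈F ⟦ μ {S} ⨾ δ ⟧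
  sem-frobˡ = ≈Ftrans (⊙-cong (FunV-⊕ {1} {2} {1} {1} dup id) (coFunV-⊕ {1} {1} {2} {1} id dup))
    (≈Ftrans (FunV-⊙R _ _) λ { (x ∷ y ∷ []) (a ∷ b ∷ []) → iso })
    where
    iso : ∀ {x y a b : V} → IdV (x ∷ x ∷ y ∷ []) (a ∷ b ∷ b ∷ []) ↔
          Σ (Vn 1) (λ u → IdV (x ∷ y ∷ []) (u ++ u) × IdV (u ++ u) (a ∷ b ∷ []))
    iso = mk↔ₛ′ (λ { (refl , refl , refl , tt) → _ ∷ [] , (refl , refl , tt) , (refl , refl , tt) })
                (λ { ((z ∷ []) , (refl , refl , tt) , (refl , refl , tt)) → refl , refl , refl , tt })
                (λ { ((z ∷ []) , (refl , refl , tt) , (refl , refl , tt)) → refl })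
                (λ { (refl , refl , refl , tt) → refl })

  sem-frobʳ : ⟦ (id₁ {S} ⊕ δ) ⨾ (μ ⊕ id₁) ⟧ ≈F ⟦ μ {S} ⨾ δ ⟧
  sem-frobʳ = ≈Ftrans (⊙-cong (FunV-⊕ {1} {1} {1} {2} id dup) (coFunV-⊕ {2} {1} {1} {1} dup id))
    (≈Ftrans (FunV-⊙R _ _) λ { (x ∷ y ∷ []) (a ∷ b ∷ []) → iso })
    where
    iso : ∀ {x y a b : V} → IdV (x ∷ y ∷ y ∷ []) (a ∷ a ∷ b ∷ []) ↔
          Σ (Vn 1) (λ u → IdV (x ∷ y ∷ []) (u ++ u) × IdV (u ++ u) (a ∷ b ∷ []))
    iso = mk↔ₛ′ (λ { (refl , refl , refl , tt) → _ ∷ [] , (refl , refl , tt) , (refl , refl , tt) })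
                (λ { ((z ∷ []) , (refl , refl , tt) , (refl , refl , tt)) → refl , refl , refl , tt })
                (λ { ((z ∷ []) , (refl , refl , tt) , (refl , refl , tt)) → refl })
                (λ { (refl , refl , refl , tt) → refl })

  sem-special : ⟦ δ {S} ⨾ μ ⟧ ≈F ⟦ id₁ {S} ⟧
  sem-special = ≈Ftrans (FunV-⊙R _ _) λ { (x ∷ []) (a ∷ []) → IdV-propI (λ { refl → refl }) (λ { refl → refl }) }

  sound≈ : ∀ {n m} {c d : Term S n m} → c ≈ d → ⟦ c ⟧ ≈F ⟦ d ⟧
  sound≈ ≈-refl = ≈Frefl
  sound≈ (≈-sym p) = ≈Fsym (sound≈ p)
  sound≈ (≈-trans p q) = ≈Ftrans (sound≈ p) (sound≈ q)
  sound≈ (⨾-cong p q) = ⊙-cong (sound≈ p) (sound≈ q)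
  sound≈ (⊕-cong p q) = ⊕F-cong (sound≈ p) (sound≈ q)
  sound≈ (⨾-assoc c d e) = ⊙-assoc ⟦ c ⟧ ⟦ d ⟧ ⟦ e ⟧
  sound≈ (⨾-idˡ c) = sem-⨾-idˡ c
  sound≈ (⨾-idʳ c) = sem-⨾-idʳ c
  sound≈ (⊕-assoc c d e) = sem-⊕-assoc c d e
  sound≈ (⊕-idˡ c) = sem-⊕-idˡ c
  sound≈ (⊕-idʳ c) = sem-⊕-idʳ c
  sound≈ (⊕-id n m) = sem-⊕-id n m
  sound≈ (interchange c d c' d') = sem-interchange c d c' d'
  sound≈ (σ-inv n m) = sem-σ-inv n m
  sound≈ (σ-nat c d) = sem-σ-nat c d
  sound≈ (σ-hexˡ n m p) = sem-σ-hexˡ n m p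
  sound≈ (σ-hexʳ n m p) = sem-σ-hexʳ n m p
  sound≈ δ-coassoc = sem-δ-coassoc
  sound≈ δ-counitˡ = sem-δ-counitˡ
  sound≈ δ-counitʳ = sem-δ-counitʳ
  sound≈ δ-comm = sem-δ-comm
  sound≈ μ-assoc = sem-μ-assoc
  sound≈ μ-unitˡ = sem-μ-unitˡ
  sound≈ μ-unitʳ = sem-μ-unitʳ
  sound≈ μ-comm = sem-μ-comm
  sound≈ frobˡ = sem-frobˡ
  sound≈ frobʳ = sem-frobʳ
  sound≈ special = sem-special

  sound⊑ : ∀ {n m} {c d : Term S n m} → c ⊑ d → ⟦ c ⟧ ⊆F ⟦ d ⟧
  sound⊑ (≈⇒⊑ p) v w = to (sound≈ p v w)
  sound⊑ (⊑-trans p q) v w r = sound⊑ q v w (sound⊑ p v w r)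
  sound⊑ (⨾-mono p q) v w (u , r , s) = u , sound⊑ p _ _ r , sound⊑ q _ _ s
  sound⊑ (⊕-mono p q) v w (r , s) = sound⊑ p _ _ r , sound⊑ q _ _ s
  sound⊑ ax-εη v w q = [] , tt , tt
  sound⊑ ax-ηε [] [] q = tt
  sound⊑ ax-δμ v w q = v ++ v , reflV _ , ≡⇒IdV (cong dup (IdV⇒≡ q))
  sound⊑ ax-μδ v w (u , p , q) = from (idₙ-sem 2 v w) (≡⇒IdV (trans (IdV⇒≡ p) (IdV⇒≡ q)))
  sound⊑ (ax-δ R) v w (u , (e , s , t) , d) =
    v ++ v , from (δₙ-sem (ar R) v (v ++ v)) (reflV _) ,
    copy (λ {k} → fstV k) (λ a → fst-++ a a) , copy (λ {k} → sndV k) (λ a → snd-++ a a)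
    where
    w≡ : u ++ u ≡ w
    w≡ = IdV⇒≡ (to (δₙ-sem (coar R) u w) d)
    -- the hyperedge e witnesses either half of the duplicated boundary
    copy : (h : ∀ {k} → Vn (k + k) → Vn k) → (∀ {k} (a : Vn k) → h (a ++ a) ≡ a) →
           ⟦ gen R ⟧ (h (v ++ v)) (h w)
    copy h h-dup = e , ≡⇒IdV (trans (IdV⇒≡ s) (sym (h-dup v))) ,
                   ≡⇒IdV (trans (IdV⇒≡ t) (trans (sym (h-dup u)) (cong h w≡)))
  sound⊑ (ax-ε R) v w (u , r , z) = from (εₙ-sem (ar R) v w) (from (IdV0 [] w) tt)

  unitVn : ⊤ ↔ Vn 0
  unitVn = mk↔ₛ′ (λ _ → []) (λ _ → tt) (λ { [] → refl }) (λ _ → refl)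

  model-φ-nat : ∀ {n m p q} (c : Term S n m) (d : Term S p q) →
           graph (to (appI n {p})) ⨾ˢ spanOf ⟦ c ⊕ d ⟧
             ≅ (spanOf ⟦ c ⟧ ⊗ˢ spanOf ⟦ d ⟧) ⨾ˢ graph (to (appI m {q}))
  model-φ-nat {n} {m} {p} {q} c d =
    graph (to (appI n {p})) ⨾ˢ spanOf ⟦ c ⊕ d ⟧
      ≅⟨ s⨾-cong (graphTo (appI n)) (≅at (spanOf ⟦ c ⊕ d ⟧)) ⟩
    span (Vn (n + p)) (from (appI n)) id ⨾ˢ spanOf ⟦ c ⊕ d ⟧
      ≅⟨ cograph-⨾ (from (appI n)) (spanOf ⟦ c ⊕ d ⟧) ⟩
    span (apex (spanOf ⟦ c ⊕ d ⟧)) (from (appI n) ∘ lft (spanOf ⟦ c ⊕ d ⟧)) (rgt (spanOf ⟦ c ⊕ d ⟧))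
      ≅⟨ legsExt (λ _ → refl) (λ z → sym (strictlyInverseˡ (appI m) (proj₂ (proj₁ z)))) ⟩
    span (apex (spanOf ⟦ c ⊕ d ⟧)) (from (appI n) ∘ lft (spanOf ⟦ c ⊕ d ⟧))
                                   (to (appI m) ∘ from (appI m) ∘ rgt (spanOf ⟦ c ⊕ d ⟧))
      ≅⟨ mapLegs id (to (appI m)) (spanOf-⊕F ⟦ c ⟧ ⟦ d ⟧) ⟩
    span (apex (spanOf ⟦ c ⟧ ⊗ˢ spanOf ⟦ d ⟧)) (lft (spanOf ⟦ c ⟧ ⊗ˢ spanOf ⟦ d ⟧))
                                              (to (appI m) ∘ rgt (spanOf ⟦ c ⟧ ⊗ˢ spanOf ⟦ d ⟧))
      ≅⟨ ≅sym (⨾-graph (spanOf ⟦ c ⟧ ⊗ˢ spanOf ⟦ d ⟧) (to (appI m))) ⟩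
    (spanOf ⟦ c ⟧ ⊗ˢ spanOf ⟦ d ⟧) ⨾ˢ graph (to (appI m {q})) ∎ˢ

  model-pres-δ : ∀ n → spanOf ⟦ δₙ n ⟧ ⨾ˢ graph (from (appI n)) ≅ δˢ (Vn n)
  model-pres-δ n =
        spanOf ⟦ δₙ n ⟧ ⨾ˢ graph (from (appI n))
          ≅⟨ s⨾-cong (spanOf-≈Fun dup (δₙ-sem n)) (≅at (graph (from (appI n)))) ⟩
        graph dup ⨾ˢ graph (from (appI n))
          ≅⟨ graph-⨾ dup (from (appI n)) ⟩
        graph (from (appI n) ∘ dup)
          ≅⟨ legsExt (λ _ → refl) (λ v → cong₂ _,_ (fst-++ v v) (snd-++ v v)) ⟩
        δˢ (Vn n) ∎ˢ

  model-pres-ε : ∀ n → spanOf ⟦ εₙ n ⟧ ⨾ˢ graph (from unitVn) ≅ εˢ (Vn n)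
  model-pres-ε n =
        spanOf ⟦ εₙ n ⟧ ⨾ˢ graph (from unitVn)
          ≅⟨ s⨾-cong (spanOf-≈Fun (λ _ → []) (εₙ-sem n)) (≅at (graph (from unitVn))) ⟩
        graph (λ (_ : Vn n) → []) ⨾ˢ graph (from unitVn)
          ≅⟨ graph-⨾ (λ _ → []) (λ _ → tt) ⟩
        εˢ (Vn n) ∎ˢ

  model-pres-μ : ∀ n → graph (to (appI n)) ⨾ˢ spanOf ⟦ μₙ n ⟧ ≅ μˢ (Vn n)
  model-pres-μ n =
        graph (to (appI n)) ⨾ˢ spanOf ⟦ μₙ n ⟧
          ≅⟨ s⨾-cong (graphTo (appI n)) (spanOf-≈coFun dup (μₙ-sem n)) ⟩
        span (Vn (n + n)) (from (appI n)) id ⨾ˢ span (Vn n) dup id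
          ≅⟨ cograph-⨾ (from (appI n)) (span (Vn n) dup id) ⟩
        span (Vn n) (from (appI n) ∘ dup) id
          ≅⟨ legsExt (λ v → cong₂ _,_ (fst-++ v v) (snd-++ v v)) (λ _ → refl) ⟩
        μˢ (Vn n) ∎ˢ

  model-pres-η : ∀ n → graph (to unitVn) ⨾ˢ spanOf ⟦ ηₙ n ⟧ ≅ ηˢ (Vn n)
  model-pres-η n =
        graph (to unitVn) ⨾ˢ spanOf ⟦ ηₙ n ⟧
          ≅⟨ s⨾-cong (graphTo unitVn) (spanOf-≈coFun (λ _ → []) (ηₙ-sem n)) ⟩
        span (Vn 0) (from unitVn) id ⨾ˢ span (Vn n) (λ _ → []) id
          ≅⟨ cograph-⨾ (λ _ → tt) (span (Vn n) (λ _ → []) id) ⟩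
        ηˢ (Vn n) ∎ˢ

  modelOf : Morph S
  modelOf = record
    { Ob = Vn
    ; Hom = λ c → spanOf ⟦ c ⟧
    ; Hom-≈ = λ p → un (spanOf-cong (sound≈ p))
    ; Hom-⊑ = λ p → spanOf-mono (sound⊑ p)
    ; Hom-id = λ n → un (spanOf-≈Fun id (idₙ-sem n))
    ; Hom-⨾ = λ c d → un (spanOf-⨾ ⟦ c ⟧ ⟦ d ⟧)
    ; φ = λ n m → appI n
    ; φ₀ = unitVn
    ; φ-nat = λ c d → un (model-φ-nat c d)
    ; φ-assoc = λ n m p x y z → sym (reassocL (sym (+-assoc n m p)) x y z)
    ; φ-unitˡ = λ n x → refl
    ; φ-unitʳ = λ n x → vecEq _ _ (trans (toList-++ x []) (trans (ListP.++-identityʳ _) (sym (toList-subst _ x))))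
    ; pres-δ = λ n → un (model-pres-δ n)
    ; pres-ε = λ n → un (model-pres-ε n)
    ; pres-μ = λ n → un (model-pres-μ n)
    ; pres-η = λ n → un (model-pres-η n)
    }

  spanOf-gen : ∀ R → spanOf ⟦ gen R ⟧ ≅ span (E R) src tgt
  spanOf-gen R = mk≅ (mk↔ₛ′ (λ z → proj₁ (proj₂ z)) (λ e → (src e , tgt e) , e , reflV _ , reflV _) (λ _ → refl) gf)
                (λ z → IdV⇒≡ (proj₁ (proj₂ (proj₂ z))))
                (λ z → IdV⇒≡ (proj₂ (proj₂ (proj₂ z))))
    where
    gf : ∀ z → ((src (proj₁ (proj₂ z)) , tgt (proj₁ (proj₂ z))) , proj₁ (proj₂ z) , reflV _ , reflV _) ≡ z
    gf ((v , w) , e , p , q) with IdV⇒≡ p | IdV⇒≡ q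
    ... | refl | refl = cong₂ (λ p q → ((src e , tgt e) , e , p , q)) (IdV-prop _ _) (IdV-prop _ _)

module Rigidity (S : Signature) (N : Morph S) (G : Hypergraph S)
                (κ : Hypergraph.V G ↔ Morph.Ob N 1) where

  open Signature S
  open Hypergraph G
  open Semantics S G
  open Morph N

  pack : ∀ n → Vn n → Ob n
  pack zero [] = to φ₀ tt
  pack (suc n) (x ∷ v) = to (φ 1 n) (to κ x , pack n v)

  unpackV : ∀ n → Ob n → Vn n
  unpackV zero z = []
  unpackV (suc n) z = from κ (proj₁ (from (φ 1 n) z)) ∷ unpackV n (proj₂ (from (φ 1 n) z))

  unpackV-pack : ∀ n (v : Vn n) → unpackV n (pack n v) ≡ v
  unpackV-pack zero [] = refl
  unpackV-pack (suc n) (x ∷ v) rewrite strictlyInverseʳ (φ 1 n) (to κ x , pack n v)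
    = cong₂ _∷_ (strictlyInverseʳ κ x) (unpackV-pack n v)

  pack-unpackV : ∀ n (z : Ob n) → pack n (unpackV n z) ≡ z
  pack-unpackV zero z = strictlyInverseˡ φ₀ z
  pack-unpackV (suc n) z =
    trans (cong₂ (λ a b → to (φ 1 n) (a , b)) (strictlyInverseˡ κ _) (pack-unpackV n _))
          (strictlyInverseˡ (φ 1 n) z)

  packI : ∀ n → Vn n ↔ Ob n
  packI n = mk↔ₛ′ (pack n) (unpackV n) (pack-unpackV n) (unpackV-pack n)

  pack-inj : ∀ {n} {u u' : Vn n} → pack n u ≡ pack n u' → u ≡ u'
  pack-inj {n} {u} {u'} e = trans (sym (unpackV-pack n u)) (trans (cong (unpackV n) e) (unpackV-pack n u'))

  pack-++ : ∀ {n m} (a : Vn n) (b : Vn m) → pack (n + m) (a ++ b) ≡ to (φ n m) (pack n a , pack m b)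
  pack-++ {m = m} [] b = sym (φ-unitˡ m (pack m b))
  pack-++ {suc n} {m} (x ∷ a) b =
    trans (cong (λ z → to (φ 1 (n + m)) (to κ x , z)) (pack-++ a b))
          (sym (φ-assoc 1 n m (to κ x) (pack n a) (pack m b)))

  pack-singleton : ∀ x → pack 1 (x ∷ []) ≡ to κ x
  pack-singleton x = φ-unitʳ 1 (to κ x)

  packSpan : ∀ {n m} → Fam (Vn n) (Vn m) → Span (Ob n) (Ob m)
  packSpan {n} {m} R = span (apex (spanOf R)) (pack n ∘ lft (spanOf R)) (pack m ∘ rgt (spanOf R))

  packSpan-cong : ∀ {n m} {R T : Fam (Vn n) (Vn m)} → R ≈F T → packSpan R ≅ packSpan T
  packSpan-cong {n} {m} e = mapLegs (pack n) (pack m) (spanOf-cong e)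

  packSpan-⨾ : ∀ {n k m} (R : Fam (Vn n) (Vn k)) (T : Fam (Vn k) (Vn m)) →
               packSpan R ⨾ˢ packSpan T ≅ packSpan (R ⊙ T)
  packSpan-⨾ {n} {k} {m} R T = mk≅ (mk↔ₛ′ glue unglue glue-unglue unglue-glue) lft-glue rgt-glue
    where
    -- the pullback over Ob k is computed on vectors, since pack is injective
    glue : apex (packSpan R ⨾ˢ packSpan T) → apex (packSpan (R ⊙ T))
    glue ((((v , u) , r) , ((u' , w) , s)) , e) with pack-inj e
    ... | refl = (v , w) , u , r , s
    unglue : apex (packSpan (R ⊙ T)) → apex (packSpan R ⨾ˢ packSpan T)
    unglue ((v , w) , u , r , s) = (((v , u) , r) , ((u , w) , s)) , refl
    glue-unglue : ∀ z → glue (unglue z) ≡ z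
    glue-unglue ((v , w) , u , r , s) with pack-inj {u = u} {u} refl
    ... | refl = refl
    unglue-glue : ∀ z → unglue (glue z) ≡ z
    unglue-glue ((((v , u) , r) , ((u' , w) , s)) , e) with pack-inj e
    ... | refl = cong (λ e → (((v , u) , r) , ((u , w) , s)) , e) (uip _ _)
    lft-glue : ∀ z → pack n (proj₁ (proj₁ (glue z))) ≡ pack n (proj₁ (proj₁ (proj₁ (proj₁ z))))
    lft-glue ((((v , u) , r) , ((u' , w) , s)) , e) with pack-inj e
    ... | refl = refl
    rgt-glue : ∀ z → pack m (proj₂ (proj₁ (glue z))) ≡ pack m (proj₂ (proj₁ (proj₂ (proj₁ z))))
    rgt-glue ((((v , u) , r) , ((u' , w) , s)) , e) with pack-inj e
    ... | refl = refl

  packSpan-Fun : ∀ {n m} (f : Vn n → Vn m) (h : Ob n → Ob m) → (∀ v → h (pack n v) ≡ pack m (f v)) →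
                 packSpan (FunV f) ≅ graph h
  packSpan-Fun {n} {m} f h e =
    packSpan (FunV f)                    ≅⟨ mapLegs (pack n) (pack m) (spanOf-FunV f) ⟩
    span (Vn n) (pack n) (pack m ∘ f)    ≅⟨ legsExt (λ _ → refl) (λ v → sym (e v)) ⟩
    span (Vn n) (id ∘ pack n) (h ∘ pack n) ≅⟨ reindex (packI n) id h ⟩
    graph h ∎ˢ

  packSpan-coFun : ∀ {n m} (f : Vn m → Vn n) (h : Ob m → Ob n) → (∀ v → h (pack m v) ≡ pack n (f v)) →
                   packSpan (coFunV f) ≅ span (Ob m) h id
  packSpan-coFun {n} {m} f h e =
    packSpan (coFunV f)                    ≅⟨ mapLegs (pack n) (pack m) (spanOf-coFunV f) ⟩
    span (Vn m) (pack n ∘ f) (pack m)      ≅⟨ legsExt (λ v → sym (e v)) (λ _ → refl) ⟩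
    span (Vn m) (h ∘ pack m) (id ∘ pack m) ≅⟨ reindex (packI m) h id ⟩
    span (Ob m) h id ∎ˢ

  idₙ-one : idₙ {S} 1 ≈ id₁
  idₙ-one = ⊕-idʳ id₁

  εₙ-one : εₙ {S} 1 ≈ ε
  εₙ-one = ⊕-idʳ ε

  ηₙ-one : ηₙ {S} 1 ≈ η
  ηₙ-one = ⊕-idʳ η

  δₙ-one : δₙ {S} 1 ≈ δ
  δₙ-one = ≈-trans (⨾-cong (⊕-idʳ δ) (⊕-cong ≈-refl (≈-trans (⊕-idʳ (σₙ 1 0)) (⨾-idˡ (idₙ 1))))) (⨾-idʳ δ)

  μₙ-one : μₙ {S} 1 ≈ μ
  μₙ-one = ≈-trans (⨾-cong (⊕-cong ≈-refl (⊕-idʳ (idₙ 1))) (⊕-idʳ μ)) (⨾-idˡ μ)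

  σₙ-one : σₙ {S} 1 1 ≈ σ
  σₙ-one = ≈-trans (⨾-idˡ _) (≈-trans (⊕-idʳ _)
             (≈-trans (⨾-cong (⊕-idʳ σ) (⊕-cong ≈-refl (≈-sym (⊕-idʳ id₁)))) (⨾-idʳ σ)))

  -- the equations that pin down the image of σ
  σ-involutive : σ {S} ⨾ σ ≈ idₙ 2
  σ-involutive = ≈-trans (⨾-cong (≈-sym σₙ-one) (≈-sym σₙ-one)) (σ-inv 1 1)

  σ-moves-ε-right : ε {S} ⊕ id₁ ≈ σ ⨾ (id₁ ⊕ ε)
  σ-moves-ε-right = ≈-trans (≈-sym (⨾-idʳ _)) (≈-trans (σ-nat ε id₁) (⨾-cong σₙ-one ≈-refl))

  σ-moves-ε-left : id₁ {S} ⊕ ε ≈ σ ⨾ (ε ⊕ id₁)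
  σ-moves-ε-left = ≈-trans (≈-sym (⨾-idʳ _)) (≈-trans (⨾-cong ≈-refl (≈-sym (⨾-idˡ (idₙ 1))))
                     (≈-trans (σ-nat id₁ ε) (⨾-cong σₙ-one ≈-refl)))

  Hom-resp-≈ : ∀ {n m} {c d : Term S n m} → c ≈ d → Hom c ≅ Hom d
  Hom-resp-≈ p = ⟪ Hom-≈ p ⟫

  Hom-comp : ∀ {n k m} (c : Term S n k) (d : Term S k m) → Hom (c ⨾ d) ≅ Hom c ⨾ˢ Hom d
  Hom-comp c d = ⟪ Hom-⨾ c d ⟫

  Hom-idₙ : ∀ n → Hom (idₙ n) ≅ idˢ (Ob n)
  Hom-idₙ n = ⟪ Hom-id n ⟫

  Hom-⊕ : ∀ {n m p q} (c : Term S n m) (d : Term S p q) →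
          Hom (c ⊕ d) ≅ graph (from (φ n p)) ⨾ˢ ((Hom c ⊗ˢ Hom d) ⨾ˢ graph (to (φ m q)))
  Hom-⊕ {n} {m} {p} {q} c d =
    precancel (to (φ n p)) (from (φ n p)) (strictlyInverseˡ (φ n p)) ⟪ φ-nat c d ⟫

  Hom-⊕-graphs : ∀ {n m p q} (c : Term S n m) (d : Term S p q) (hc : Ob n → Ob m) (hd : Ob p → Ob q) →
                 Hom c ≅ graph hc → Hom d ≅ graph hd →
                 Hom (c ⊕ d) ≅ graph (λ z → to (φ m q) (map× hc hd (from (φ n p) z)))
  Hom-⊕-graphs {n} {m} {p} {q} c d hc hd ec ed =
    Hom (c ⊕ d) ≅⟨ Hom-⊕ c d ⟩
    graph (from (φ n p)) ⨾ˢ ((Hom c ⊗ˢ Hom d) ⨾ˢ graph (to (φ m q)))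
      ≅⟨ s⨾-cong (≅at (graph (from (φ n p)))) (s⨾-cong (⊗-cong ec ed) (≅at (graph (to (φ m q))))) ⟩
    graph (from (φ n p)) ⨾ˢ (graph (map× hc hd) ⨾ˢ graph (to (φ m q)))
      ≅⟨ s⨾-cong (≅at (graph (from (φ n p)))) (graph-⨾ (map× hc hd) (to (φ m q))) ⟩
    graph (from (φ n p)) ⨾ˢ graph (to (φ m q) ∘ map× hc hd)
      ≅⟨ graph-⨾ (from (φ n p)) (to (φ m q) ∘ map× hc hd) ⟩
    graph (λ z → to (φ m q) (map× hc hd (from (φ n p) z))) ∎ˢ

  ob₀ : Ob 0
  ob₀ = to φ₀ tt

  Hom-δ : Hom δ ≅ graph (λ x → to (φ 1 1) (x , x))
  Hom-δ =
    Hom δ ≅⟨ Hom-resp-≈ (≈-sym δₙ-one) ⟩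
    Hom (δₙ 1) ≅⟨ postcancel (from (φ 1 1)) (to (φ 1 1)) (strictlyInverseˡ (φ 1 1)) ⟪ pres-δ 1 ⟫ ⟩
    δˢ (Ob 1) ⨾ˢ graph (to (φ 1 1)) ≅⟨ graph-⨾ (λ x → x , x) (to (φ 1 1)) ⟩
    graph (λ x → to (φ 1 1) (x , x)) ∎ˢ

  Hom-ε : Hom ε ≅ graph (λ (_ : Ob 1) → ob₀)
  Hom-ε =
    Hom ε ≅⟨ Hom-resp-≈ (≈-sym εₙ-one) ⟩
    Hom (εₙ 1) ≅⟨ postcancel (from φ₀) (to φ₀) (strictlyInverseˡ φ₀) ⟪ pres-ε 1 ⟫ ⟩
    εˢ (Ob 1) ⨾ˢ graph (to φ₀) ≅⟨ graph-⨾ (λ _ → tt) (to φ₀) ⟩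
    graph (λ (_ : Ob 1) → ob₀) ∎ˢ

  Hom-μ : Hom μ ≅ span (Ob 1) (λ x → to (φ 1 1) (x , x)) id
  Hom-μ =
    Hom μ ≅⟨ Hom-resp-≈ (≈-sym μₙ-one) ⟩
    Hom (μₙ 1) ≅⟨ precancel (to (φ 1 1)) (from (φ 1 1)) (strictlyInverseˡ (φ 1 1)) ⟪ pres-μ 1 ⟫ ⟩
    graph (from (φ 1 1)) ⨾ˢ μˢ (Ob 1) ≅⟨ s⨾-cong (graphFrom (φ 1 1)) (≅at (μˢ (Ob 1))) ⟩
    span (Ob 1 × Ob 1) (to (φ 1 1)) id ⨾ˢ μˢ (Ob 1) ≅⟨ cograph-⨾ (to (φ 1 1)) (μˢ (Ob 1)) ⟩
    span (Ob 1) (λ x → to (φ 1 1) (x , x)) id ∎ˢ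

  Hom-η : Hom η ≅ span (Ob 1) (λ _ → ob₀) id
  Hom-η =
    Hom η ≅⟨ Hom-resp-≈ (≈-sym ηₙ-one) ⟩
    Hom (ηₙ 1) ≅⟨ precancel (to φ₀) (from φ₀) (strictlyInverseˡ φ₀) ⟪ pres-η 1 ⟫ ⟩
    graph (from φ₀) ⨾ˢ ηˢ (Ob 1) ≅⟨ s⨾-cong (graphFrom φ₀) (≅at (ηˢ (Ob 1))) ⟩
    span ⊤ (to φ₀) id ⨾ˢ ηˢ (Ob 1) ≅⟨ cograph-⨾ (to φ₀) (ηˢ (Ob 1)) ⟩
    span (Ob 1) (λ _ → ob₀) id ∎ˢ

  Hom-id₁ : Hom id₁ ≅ graph (λ (x : Ob 1) → x)
  Hom-id₁ = ≅trans (Hom-resp-≈ (≈-sym idₙ-one)) (Hom-idₙ 1)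

  -- The symmetry is forced as well: N(σ) is the graph of an involution τ
  -- (selfInverse), and transporting ε ⊕ id₁ and id₁ ⊕ ε across τ shows that
  -- τ exchanges the two factors of N(2) ≅ N(1) × N(1).
  swapOb : Ob 2 → Ob 2
  swapOb z = to (φ 1 1) (swap (from (φ 1 1) z))

  Hom-σ : Hom σ ≅ graph swapOb
  Hom-σ = ≅trans (proj₂ σ-graph) (graph-ext τ≡swap)
    where
    σ-graph = selfInverse (Hom σ) (≅trans (≅sym (Hom-comp σ σ)) (≅trans (Hom-resp-≈ σ-involutive) (Hom-idₙ 2)))
    τ = proj₁ σ-graph
    -- projections N(2) → N(1), written as N(ε ⊕ id₁) and N(id₁ ⊕ ε)
    drop₁ drop₂ : Ob 2 → Ob 1
    drop₁ z = to (φ 0 1) (map× (λ _ → ob₀) id (from (φ 1 1) z))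
    drop₂ z = to (φ 1 0) (map× id (λ _ → ob₀) (from (φ 1 1) z))
    drop₁-τ : ∀ z → drop₁ z ≡ drop₂ (τ z)
    drop₁-τ = graph-eq (
      graph drop₁                     ≅⟨ ≅sym (Hom-⊕-graphs ε id₁ _ _ Hom-ε Hom-id₁) ⟩
      Hom (ε ⊕ id₁)                   ≅⟨ Hom-resp-≈ σ-moves-ε-right ⟩
      Hom (σ ⨾ (id₁ ⊕ ε))             ≅⟨ Hom-comp σ (id₁ ⊕ ε) ⟩
      Hom σ ⨾ˢ Hom (id₁ ⊕ ε)          ≅⟨ s⨾-cong (proj₂ σ-graph) (Hom-⊕-graphs id₁ ε _ _ Hom-id₁ Hom-ε) ⟩
      graph τ ⨾ˢ graph drop₂          ≅⟨ graph-⨾ τ drop₂ ⟩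
      graph (drop₂ ∘ τ) ∎ˢ)
    drop₂-τ : ∀ z → drop₂ z ≡ drop₁ (τ z)
    drop₂-τ = graph-eq (
      graph drop₂                     ≅⟨ ≅sym (Hom-⊕-graphs id₁ ε _ _ Hom-id₁ Hom-ε) ⟩
      Hom (id₁ ⊕ ε)                   ≅⟨ Hom-resp-≈ σ-moves-ε-left ⟩
      Hom (σ ⨾ (ε ⊕ id₁))             ≅⟨ Hom-comp σ (ε ⊕ id₁) ⟩
      Hom σ ⨾ˢ Hom (ε ⊕ id₁)          ≅⟨ s⨾-cong (proj₂ σ-graph) (Hom-⊕-graphs ε id₁ _ _ Hom-ε Hom-id₁) ⟩
      graph τ ⨾ˢ graph drop₁          ≅⟨ graph-⨾ τ drop₁ ⟩
      graph (drop₁ ∘ τ) ∎ˢ)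
    τ≡swap : ∀ z → τ z ≡ swapOb z
    τ≡swap z = trans (sym (strictlyInverseˡ (φ 1 1) (τ z)))
                 (cong (to (φ 1 1)) (cong₂ _,_
                   (trans (sym (φ-unitʳ 1 _)) (trans (sym (drop₁-τ z)) (φ-unitˡ 1 _)))
                   (trans (sym (φ-unitˡ 1 _)) (trans (sym (drop₂-τ z)) (φ-unitʳ 1 _)))))

  packSpan-⊕ : ∀ {n m p q} (R : Fam (Vn n) (Vn m)) (T : Fam (Vn p) (Vn q)) →
               graph (from (φ n p)) ⨾ˢ ((packSpan R ⊗ˢ packSpan T) ⨾ˢ graph (to (φ m q))) ≅ packSpan (R ⊕F T)
  packSpan-⊕ {n} {m} {p} {q} R T =
    graph (from (φ n p)) ⨾ˢ ((packSpan R ⊗ˢ packSpan T) ⨾ˢ graph (to (φ m q)))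
      ≅⟨ s⨾-cong (graphFrom (φ n p)) (⨾-graph (packSpan R ⊗ˢ packSpan T) (to (φ m q))) ⟩
    span (Ob n × Ob p) (to (φ n p)) id ⨾ˢ span A (lft (packSpan R ⊗ˢ packSpan T)) (to (φ m q) ∘ rgt (packSpan R ⊗ˢ packSpan T))
      ≅⟨ cograph-⨾ (to (φ n p)) (span A (lft (packSpan R ⊗ˢ packSpan T)) (to (φ m q) ∘ rgt (packSpan R ⊗ˢ packSpan T))) ⟩
    span A (to (φ n p) ∘ lft (packSpan R ⊗ˢ packSpan T)) (to (φ m q) ∘ rgt (packSpan R ⊗ˢ packSpan T))
      ≅⟨ legsExt (λ z → sym (pack-++ (proj₁ (proj₁ (proj₁ z))) (proj₁ (proj₁ (proj₂ z)))))
                 (λ z → sym (pack-++ (proj₂ (proj₁ (proj₁ z))) (proj₂ (proj₁ (proj₂ z))))) ⟩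
    span A (packBlocks n p ∘ lft (spanOf R ⊗ˢ spanOf T)) (packBlocks m q ∘ rgt (spanOf R ⊗ˢ spanOf T))
      ≅⟨ ≅sym (mapLegs (packBlocks n p) (packBlocks m q) (spanOf-⊕F R T)) ⟩
    span (apex (spanOf (R ⊕F T))) (packBlocks n p ∘ from (appI n) ∘ lft (spanOf (R ⊕F T)))
                                  (packBlocks m q ∘ from (appI m) ∘ rgt (spanOf (R ⊕F T)))
      ≅⟨ legsExt (λ z → cong (pack (n + p)) (fs-++ n (proj₁ (proj₁ z))))
                 (λ z → cong (pack (m + q)) (fs-++ m (proj₂ (proj₁ z)))) ⟩
    packSpan (R ⊕F T) ∎ˢ
    where
    A = apex (spanOf R) × apex (spanOf T)
    packBlocks : ∀ k l → Vn k × Vn l → Ob (k + l)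
    packBlocks k l (a , b) = pack (k + l) (a ++ b)

  module Determined (on-generators : ∀ R → Hom (gen R) ≅ span (E R) (pack (ar R) ∘ src) (pack (coar R) ∘ tgt)) where

    pack-dup : (x : V) → to (φ 1 1) (pack 1 (x ∷ []) , pack 1 (x ∷ [])) ≡ pack 2 (x ∷ x ∷ [])
    pack-dup x = trans (cong₂ (λ a b → to (φ 1 1) (a , b)) (pack-singleton x) (pack-singleton x))
                       (cong (λ b → to (φ 1 1) (to κ x , b)) (sym (pack-singleton x)))

    pack-swap : (x y : V) → swapOb (pack 2 (x ∷ y ∷ [])) ≡ pack 2 (y ∷ x ∷ [])
    pack-swap x y = trans (cong (λ z → to (φ 1 1) (swap z)) (strictlyInverseʳ (φ 1 1) (to κ x , pack 1 (y ∷ []))))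
                          (cong₂ (λ a b → to (φ 1 1) (a , b)) (pack-singleton y) (sym (pack-singleton x)))

    Hom-via-semantics : ∀ {n m} (c : Term S n m) → Hom c ≅ packSpan ⟦ c ⟧
    Hom-via-semantics δ = ≅trans Hom-δ (≅sym (packSpan-Fun dup _ λ { (x ∷ []) → pack-dup x }))
    Hom-via-semantics ε = ≅trans Hom-ε (≅sym (≅trans (packSpan-cong ε-sem) (packSpan-Fun (λ _ → []) _ (λ _ → refl))))
    Hom-via-semantics μ = ≅trans Hom-μ (≅sym (packSpan-coFun dup _ λ { (x ∷ []) → pack-dup x }))
    Hom-via-semantics η = ≅trans Hom-η (≅sym (≅trans (packSpan-cong η-sem) (packSpan-coFun (λ _ → []) _ (λ _ → refl))))
    Hom-via-semantics id₀ = ≅trans (Hom-idₙ 0) (≅sym (packSpan-Fun id id (λ _ → refl)))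
    Hom-via-semantics id₁ = ≅trans Hom-id₁ (≅sym (packSpan-Fun id id (λ _ → refl)))
    Hom-via-semantics σ = ≅trans Hom-σ (≅sym (packSpan-Fun (rot 1 1) swapOb λ { (x ∷ y ∷ []) → pack-swap x y }))
    Hom-via-semantics (gen R) = ≅trans (on-generators R) (≅sym (mapLegs (pack (ar R)) (pack (coar R)) (spanOf-gen R)))
    Hom-via-semantics (c ⨾ d) =
      ≅trans (Hom-comp c d) (≅trans (s⨾-cong (Hom-via-semantics c) (Hom-via-semantics d)) (packSpan-⨾ ⟦ c ⟧ ⟦ d ⟧))
    Hom-via-semantics (_⊕_ {n} {m} {p} {q} c d) =
      ≅trans (Hom-⊕ c d)
      (≅trans (s⨾-cong (≅at (graph (from (φ n p))))
                       (s⨾-cong (⊗-cong (Hom-via-semantics c) (Hom-via-semantics d)) (≅at (graph (to (φ m q))))))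
              (packSpan-⊕ ⟦ c ⟧ ⟦ d ⟧))

    pack-natural : ∀ {n m} (c : Term S n m) → spanOf ⟦ c ⟧ ⨾ˢ graph (pack m) ≅ graph (pack n) ⨾ˢ Hom c
    pack-natural {n} {m} c =
      spanOf ⟦ c ⟧ ⨾ˢ graph (pack m) ≅⟨ ⨾-graph (spanOf ⟦ c ⟧) (pack m) ⟩
      span (apex (packSpan ⟦ c ⟧)) (λ z → proj₁ (proj₁ z)) (λ z → pack m (proj₂ (proj₁ z)))
        ≅⟨ legsExt (λ z → sym (unpackV-pack n (proj₁ (proj₁ z)))) (λ _ → refl) ⟩
      span (apex (packSpan ⟦ c ⟧)) (unpackV n ∘ lft (packSpan ⟦ c ⟧)) (rgt (packSpan ⟦ c ⟧))
        ≅⟨ ≅sym (cograph-⨾ (unpackV n) (packSpan ⟦ c ⟧)) ⟩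
      span (Ob n) (unpackV n) id ⨾ˢ packSpan ⟦ c ⟧
        ≅⟨ s⨾-cong (≅sym (graphTo (packI n))) (≅sym (Hom-via-semantics c)) ⟩
      graph (pack n) ⨾ˢ Hom c ∎ˢ

    isoToModel : MorphIso modelOf N
    isoToModel = record
      { α = packI
      ; nat = λ c → un (pack-natural c)
      ; mon = λ n m x y → pack-++ x y
      ; mon₀ = refl
      }

module _ (S : Signature) where
  open Signature S

  modelOf : Hypergraph S → Morph S
  modelOf G = Semantics.modelOf S G

  unpack-α : (M N : Morph S) (I : MorphIso M N) → ∀ n x →
             unpack N n (to (MorphIso.α I n) x) ≡ map (to (MorphIso.α I 1)) (unpack M n x)
  unpack-α M N I zero x = refl
  unpack-α M N I (suc n) x =
    trans (cong (λ p → proj₁ p ∷ unpack N n (proj₂ p)) split-α)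
          (cong (to (α 1) a ∷_) (unpack-α M N I n b))
    where
    open MorphIso I
    module M = Morph M
    module N = Morph N
    a = proj₁ (from (M.φ 1 n) x)
    b = proj₂ (from (M.φ 1 n) x)
    split-α : from (N.φ 1 n) (to (α (suc n)) x) ≡ (to (α 1) a , to (α n) b)
    split-α = begin
      from (N.φ 1 n) (to (α (suc n)) x)                        ≡⟨ cong (λ y → from (N.φ 1 n) (to (α (suc n)) y))
                                                                       (strictlyInverseˡ (M.φ 1 n) x) ⟨
      from (N.φ 1 n) (to (α (suc n)) (to (M.φ 1 n) (a , b)))   ≡⟨ cong (from (N.φ 1 n)) (mon 1 n a b) ⟩
      from (N.φ 1 n) (to (N.φ 1 n) (to (α 1) a , to (α n) b))  ≡⟨ strictlyInverseʳ (N.φ 1 n) _ ⟩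
      (to (α 1) a , to (α n) b)                                ∎
      where open ≡-Reasoning

  -- Clause 1: isomorphic morphisms have isomorphic hypergraphs.  On vertices
  -- use α₁; on the edges of R use the apex isomorphism of the naturality
  -- square of α at R.
  hypergraphOf-resp-iso : (M N : Morph S) → MorphIso M N → HypIso (hypergraphOf M) (hypergraphOf N)
  hypergraphOf-resp-iso M N I = record
    { isoV = α 1
    ; isoE = λ R → proj₁ (un (gen-square R))
    ; srcCom = λ R e → trans (cong (unpack N (ar R)) (lft-square R e)) (unpack-α M N I (ar R) _)
    ; tgtCom = λ R e → trans (cong (unpack N (coar R)) (proj₂ (proj₂ (un (gen-square R))) e))
                             (unpack-α M N I (coar R) _)
    }
    where
    open MorphIso I
    module M = Morph M
    module N = Morph N
    gen-square : ∀ R → span (apex (M.Hom (gen R))) (lft (M.Hom (gen R))) (to (α (coar R)) ∘ rgt (M.Hom (gen R)))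
                     ≅ span (apex (N.Hom (gen R))) (from (α (ar R)) ∘ lft (N.Hom (gen R))) (rgt (N.Hom (gen R)))
    gen-square R =
      span (apex (M.Hom (gen R))) (lft (M.Hom (gen R))) (to (α (coar R)) ∘ rgt (M.Hom (gen R)))
        ≅⟨ ≅sym (⨾-graph (M.Hom (gen R)) (to (α (coar R)))) ⟩
      M.Hom (gen R) ⨾ˢ graph (to (α (coar R))) ≅⟨ ⟪ nat (gen R) ⟫ ⟩
      graph (to (α (ar R))) ⨾ˢ N.Hom (gen R)
        ≅⟨ s⨾-cong (graphTo (α (ar R))) (≅at (N.Hom (gen R))) ⟩
      span (N.Ob (ar R)) (from (α (ar R))) id ⨾ˢ N.Hom (gen R)
        ≅⟨ cograph-⨾ (from (α (ar R))) (N.Hom (gen R)) ⟩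
      span (apex (N.Hom (gen R))) (from (α (ar R)) ∘ lft (N.Hom (gen R))) (rgt (N.Hom (gen R))) ∎ˢ
    lft-square : ∀ R e → lft (N.Hom (gen R)) (to (proj₁ (un (gen-square R))) e) ≡ to (α (ar R)) (lft (M.Hom (gen R)) e)
    lft-square R e = trans (sym (strictlyInverseˡ (α (ar R)) _))
                           (cong (to (α (ar R))) (proj₁ (proj₂ (un (gen-square R))) e))

  -- Clause 2: isomorphic hypergraphs have isomorphic models.  By rigidity,
  -- with vertices of G identified with length-one vectors over H.
  modelOf-resp-iso : (G H : Hypergraph S) → HypIso G H → MorphIso (modelOf G) (modelOf H)
  modelOf-resp-iso G H hi = Rigid.Determined.isoToModel on-generators
    where
    open HypIso hi
    module G = Hypergraph G
    module H = Hypergraph H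
    module SH = Semantics S H
    κ : G.V ↔ SH.Vn 1
    κ = mk↔ₛ′ (λ x → to isoV x ∷ []) (λ { (y ∷ []) → from isoV y })
              (λ { (y ∷ []) → cong (_∷ []) (strictlyInverseˡ isoV y) }) (strictlyInverseʳ isoV)
    module Rigid = Rigidity S (modelOf H) G κ
    pack-isoV : ∀ n (v : Vec G.V n) → Rigid.pack n v ≡ map (to isoV) v
    pack-isoV zero [] = refl
    pack-isoV (suc n) (x ∷ v) = cong (to isoV x ∷_) (pack-isoV n v)
    on-generators : ∀ R → Morph.Hom (modelOf H) (gen R)
                          ≅ span (G.E R) (Rigid.pack (ar R) ∘ G.src) (Rigid.pack (coar R) ∘ G.tgt)
    on-generators R =
      spanOf SH.⟦ gen R ⟧
        ≅⟨ SH.spanOf-gen R ⟩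
      span (H.E R) H.src H.tgt
        ≅⟨ ≅sym (reindex (isoE R) H.src H.tgt) ⟩
      span (G.E R) (H.src ∘ to (isoE R)) (H.tgt ∘ to (isoE R))
        ≅⟨ legsExt (λ e → trans (srcCom R e) (sym (pack-isoV _ _)))
                   (λ e → trans (tgtCom R e) (sym (pack-isoV _ _))) ⟩
      span (G.E R) (Rigid.pack (ar R) ∘ G.src) (Rigid.pack (coar R) ∘ G.tgt) ∎ˢ

  -- Clause 3: every morphism is isomorphic to the model of its hypergraph,
  -- by rigidity, because packing inverts unpacking.
  modelOf-hypergraphOf : (M : Morph S) → MorphIso (modelOf (hypergraphOf M)) M
  modelOf-hypergraphOf M = Rigid.Determined.isoToModel on-generators
    where
    module Rigid = Rigidity S M (hypergraphOf M) ↔-refl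
    module M = Morph M
    pack-unpack : ∀ n (z : M.Ob n) → Rigid.pack n (unpack M n z) ≡ z
    pack-unpack zero z = strictlyInverseˡ M.φ₀ z
    pack-unpack (suc n) z = trans (cong (λ b → to (M.φ 1 n) (proj₁ (from (M.φ 1 n) z) , b)) (pack-unpack n _))
                                  (strictlyInverseˡ (M.φ 1 n) z)
    on-generators : ∀ R → M.Hom (gen R) ≅ span (apex (M.Hom (gen R)))
                            (Rigid.pack (ar R) ∘ unpack M (ar R) ∘ lft (M.Hom (gen R)))
                            (Rigid.pack (coar R) ∘ unpack M (coar R) ∘ rgt (M.Hom (gen R)))
    on-generators R = legsExt (λ e → sym (pack-unpack (ar R) _)) (λ e → sym (pack-unpack (coar R) _))

  -- Clause 4: the hypergraph of the model of G is G itself, up to the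
  -- identification of vertices with vectors of length one.
  hypergraphOf-modelOf : (G : Hypergraph S) → HypIso (hypergraphOf (modelOf G)) G
  hypergraphOf-modelOf G = record
    { isoV = isoV
    ; isoE = λ R → proj₁ (un (spanOf-gen R))
    ; srcCom = λ R z → trans (proj₁ (proj₂ (un (spanOf-gen R))) z) (unpack-singletons (ar R) _)
    ; tgtCom = λ R z → trans (proj₂ (proj₂ (un (spanOf-gen R))) z) (unpack-singletons (coar R) _)
    }
    where
    open Semantics S G hiding (modelOf)
    isoV : Vn 1 ↔ Hypergraph.V G
    isoV = mk↔ₛ′ (λ { (x ∷ []) → x }) (λ x → x ∷ []) (λ _ → refl) (λ { (x ∷ []) → refl })
    unpack-singletons : ∀ n (v : Vn n) → v ≡ map (to isoV) (unpack (modelOf G) n v)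
    unpack-singletons zero [] = refl
    unpack-singletons (suc n) (x ∷ v) = cong (x ∷_) (unpack-singletons n v)

mainTheorem9 : (S : Signature) →
    Σ (Hypergraph S → Morph S) λ Ψ →
      ((M N : Morph S) → MorphIso M N → HypIso (hypergraphOf M) (hypergraphOf N)) ×
      ((G H : Hypergraph S) → HypIso G H → MorphIso (Ψ G) (Ψ H)) ×
      ((M : Morph S) → MorphIso (Ψ (hypergraphOf M)) M) ×
      ((G : Hypergraph S) → HypIso (hypergraphOf (Ψ G)) G)
mainTheorem9 S =
  modelOf S ,
  hypergraphOf-resp-iso S ,
  modelOf-resp-iso S ,
  modelOf-hypergraphOf S ,
  hypergraphOf-modelOf S
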